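{- Let $S_{l_{1},\ldots,l_{k}}$ denote a spider graph with junction vertex $v$, pendant vertices $u_{1},\ldots,u_{k}$, where $k\geq 2$ and for $i=1,\ldots,k$, the length of the path from $v$ to $u_{i}$ is $l_{i}\geq 1$. Then, the number of minimal forts satisfies \[ \lvert\mathcal{F}_{S_{l_{1},\ldots,l_{k}}}\rvert = \prod_{i=1}^{k}\lvert\mathcal{F}_{P_{l_{i}-1}}\rvert + \sum_{i=1}^{k}\lvert\mathcal{F}_{P_{l_{i}-2}}\rvert\prod_{j\neq i}\lvert\mathcal{F}_{P_{l_{j}-1}}\rvert+\sum_{1\leq i<j\leq k}\lvert\mathcal{F}_{P_{l_{i}}}\rvert\lvert\mathcal{F}_{P_{l_{j}}}\rvert, \] where $\lvert\mathcal{F}_{P_{ -1}}\rvert=1$ and $\lvert\mathcal{F}_{P_{0}}\rvert=0$.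
   Context: For a graph $G=(V,E)$, a non-empty subset $F\subseteq V$ is a fort if no vertex outside $F$ has exactly one neighbor in $F$; a fort is minimal if every proper subset is not a fort. $\mathcal{F}_{G}$ denotes the collection of all minimal forts of $G$. $P_{n}$ is the path graph on $n$ vertices. A spider graph is a tree with exactly one junction vertex (vertex of degree at least 3). -}

module Defs where

open import Data.Nat using (ℕ; zero; suc; _+_; _*_; _∸_; _≡ᵇ_; _<ᵇ_)
open import Data.Bool using (Bool; true; false; _∧_; _∨_; if_then_else_)
open import Data.Fin using (Fin; toℕ)
open import Data.Fin.Subset using (Subset; _∈_; _∉_; _⊂_; _∩_; ∣_∣; Nonempty)
open import Data.Fin.Subset.Properties using (_∈?_; _⊂?_; nonempty?; anySubset?)
open import Data.Fin.Properties using (all?)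
open import Data.Vec using (Vec; []; _∷_; tabulate)
open import Data.List using (List; []; _∷_; _++_; length; filter; map; allFin)
open import Data.Nat.ListAction using (sum; product)
open import Data.Bool.ListAction using (any)
open import Data.Product using (_×_; _,_; ∃; proj₁; proj₂)
open import Relation.Nullary using (¬_; Dec; yes; no; ¬?)
open import Relation.Nullary.Decidable using (_×-dec_; _→-dec_)
open import Relation.Binary.PropositionalEquality using (_≡_; _≢_)
import Data.Nat.Properties as ℕP

record Graph : Set where
  field
    order : ℕ
    adj   : Fin order → Fin order → Bool

open Graph public

N : (G : Graph) → Fin (order G) → Subset (order G)
N G v = tabulate (adj G v)

IsFort : (G : Graph) → Subset (order G) → Set
IsFort G F = Nonempty F × (∀ v → v ∉ F → ∣ F ∩ N G v ∣ ≢ 1)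

IsMinimalFort : (G : Graph) → Subset (order G) → Set
IsMinimalFort G F = IsFort G F × (∀ F′ → F′ ⊂ F → ¬ IsFort G F′)

isFort? : (G : Graph) (F : Subset (order G)) → Dec (IsFort G F)
isFort? G F = nonempty? F ×-dec all? (λ v → ¬? (v ∈? F) →-dec ¬? (∣ F ∩ N G v ∣ ℕP.≟ 1))

private
  noSub : (G : Graph) (F : Subset (order G)) →
          Dec (∃ λ F′ → F′ ⊂ F × IsFort G F′) → Dec (∀ F′ → F′ ⊂ F → ¬ IsFort G F′)
  noSub G F (yes (F′ , s , f)) = no (λ h → h F′ s f)
  noSub G F (no ¬e) = yes (λ F′ s f → ¬e (F′ , s , f))

isMinimalFort? : (G : Graph) (F : Subset (order G)) → Dec (IsMinimalFort G F)
isMinimalFort? G F = isFort? G F ×-dec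
  noSub G F (anySubset? (λ F′ → (F′ ⊂? F) ×-dec isFort? G F′))

allSubsets : (n : ℕ) → List (Subset n)
allSubsets zero    = [] ∷ []
allSubsets (suc n) = map (true ∷_) (allSubsets n) ++ map (false ∷_) (allSubsets n)

#MinimalForts : Graph → ℕ
#MinimalForts G = length (filter (isMinimalFort? G) (allSubsets (order G)))

edgeGraph : (n : ℕ) → List (ℕ × ℕ) → Graph
edgeGraph n es = record
  { order = n
  ; adj   = λ u v → any (λ e → ((proj₁ e ≡ᵇ toℕ u) ∧ (proj₂ e ≡ᵇ toℕ v))
                             ∨ ((proj₁ e ≡ᵇ toℕ v) ∧ (proj₂ e ≡ᵇ toℕ u))) es
  }

-- Path P_m : vertices 0,…,m-1, edges {t, t+1}.
pathEdges : ℕ → List (ℕ × ℕ)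
pathEdges zero          = []
pathEdges (suc zero)    = []
pathEdges (suc (suc m)) = pathEdges (suc m) ++ ((m , suc m) ∷ [])

P : ℕ → Graph
P m = edgeGraph m (pathEdges m)

-- Spider S_{l_1,…,l_k}: junction vertex v labelled 0; the i-th leg is a
-- path v – w_1 – … – w_{l_i} = u_i whose vertices w_t are labelled
-- off_i + t, where off_i = l_1 + … + l_{i-1}.
legEdges : ℕ → ℕ → List (ℕ × ℕ)
legEdges off zero          = []
legEdges off (suc zero)    = (0 , suc off) ∷ []
legEdges off (suc (suc t)) = legEdges off (suc t) ++ ((off + suc t , off + suc (suc t)) ∷ [])

spiderEdges : ℕ → List ℕ → List (ℕ × ℕ)
spiderEdges off []           = []
spiderEdges off (len ∷ lens) = legEdges off len ++ spiderEdges (off + len) lens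

Spider : (k : ℕ) → (Fin k → ℕ) → Graph
Spider k l = edgeGraph (suc (sum ls)) (spiderEdges 0 ls)
  where ls = map l (allFin k)

Σ[<_] : (k : ℕ) → (Fin k → ℕ) → ℕ
Σ[< k ] f = sum (map f (allFin k))

Π[<_] : (k : ℕ) → (Fin k → ℕ) → ℕ
Π[< k ] f = product (map f (allFin k))

Π[<_]≠ : (k : ℕ) → Fin k → (Fin k → ℕ) → ℕ
Π[< k ]≠ i f = Π[< k ] (λ j → if toℕ j ≡ᵇ toℕ i then 1 else f j)

Σ[<_]pairs : (k : ℕ) → (Fin k → Fin k → ℕ) → ℕ
Σ[< k ]pairs g = Σ[< k ] (λ i → Σ[< k ] (λ j → if toℕ i <ᵇ toℕ j then g i j else 0))

fP : ℕ → ℕ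
fP m = #MinimalForts (P m)

-- fP₋₁ m = |𝓕_{P_{m-1}}|, with the convention |𝓕_{P_{-1}}| = 1.
-- (|𝓕_{P_0}| = 0 holds automatically: P_0 has no non-empty subsets.)
fP₋₁ : ℕ → ℕ
fP₋₁ zero    = 1
fP₋₁ (suc m) = fP m

{-# OPTIONS --safe #-}
-- A subset F of the spider is described by whether it contains the junction and by its traces on
-- the legs. A leg vertex has at most two neighbours, so along a leg the fort condition says that
-- each vertex outside F has two neighbours of equal membership; at the junction it says, if the
-- junction is outside F, that the number of legs whose first vertex lies in F is not 1.
--
-- If the junction is outside F, each leg is then empty or a fort of the path it forms, and F is a
-- fort iff at least two legs are nonempty; minimality leaves exactly two nonempty legs, each a
-- minimal fort of its path. If the junction is in F, minimality forces each leg, together with the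
-- junction, to be a fort of a path minimal among those containing the end vertex, and at most one
-- leg to start in F: otherwise dropping the junction and emptying the legs that start outside F
-- leaves a smaller fort. Counting these choices leg by leg gives elementary symmetric sums of the
-- path counts, which are the three terms of the formula.

module Submission where

open import Defs
open import Data.Bool using (Bool; true; false; _∧_; _∨_; not; _xor_; if_then_else_; T)
open import Data.Bool.Properties using (T?)
import Data.Bool.Properties as Bool
open import Data.Bool.ListAction using (any)
open import Data.Empty using (⊥-elim)
open import Data.Unit using (⊤)
open import Data.Fin using (Fin; zero; suc; toℕ)
import Data.Fin.Properties as Fin
open import Data.Fin.Subset using (Subset; _∈_; _∉_; _⊆_; _⊂_; _∩_; ∣_∣; ⊥; Nonempty)
open import Data.Fin.Subset.Properties
  using ( drop-there; drop-∷-⊆; drop-∷-⊂; s⊂s; out⊂in; ⊆-refl; ⊆-antisym; ⊂-irref; _⊂?_; anySubset?; ⊥⊆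
        ; Empty-unique)
open import Data.List using (List; []; _∷_; [_]; map; length; filter; allFin) renaming (_++_ to _++ₗ_)
import Data.List.Properties as List
open import Data.List.Relation.Unary.All using (All; []; _∷_)
import Data.List.Relation.Unary.All as All
open import Data.Nat using (ℕ; zero; suc; _+_; _*_; _∸_; _≤_; _<_; z≤n; s≤s; _≡ᵇ_; _<ᵇ_; _≤?_)
open import Data.Nat.Properties
open import Algebra.Properties.CommutativeSemigroup +-commutativeSemigroup
  using () renaming (interchange to +-interchange)
open import Data.Nat.ListAction using (sum; product)
open import Data.Product using (_×_; _,_; proj₁; proj₂; ∃)
open import Data.Product.Function.NonDependent.Propositional using (_×-⇔_)
open import Data.Sum using (_⊎_; inj₁; inj₂)
import Data.Sum as Sum
open import Data.Sum.Function.Propositional using (_⊎-⇔_)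
open import Data.Vec using ([]; _∷_; _++_; tabulate; take; drop; here; there)
import Data.Vec.Properties as Vec
open import Function using (_∘_; _$_; id; case_of_; _⇔_; mk⇔; Equivalence)
open import Function.Properties.Equivalence using () renaming (refl to ⇔-refl; sym to ⇔-sym; trans to ⇔-trans)
open import Relation.Nullary using (¬_; Dec; yes; no; does; _×-dec_)
open import Relation.Unary using (Decidable)
open import Relation.Binary.PropositionalEquality hiding ([_])
open ≡-Reasoning

-- Neighbourhoods in graphs given by edge lists

bit : Bool → ℕ
bit b = if b then 1 else 0

bit-T : ∀ {b} → T b → bit b ≡ 1
bit-T {true} _ = refl

bit-¬T : ∀ {b} → ¬ T b → bit b ≡ 0
bit-¬T {true}  ¬b = ⊥-elim (¬b _)
bit-¬T {false} _  = refl

1≤bit⇒T : ∀ {b} → 1 ≤ bit b → T b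
1≤bit⇒T {true} _ = _

T∧T⇒≡ : ∀ {a b} → T a → T b → a ≡ b
T∧T⇒≡ {true} {true} _ _ = refl

≡ᵇ-true : ∀ {m n} → (m ≡ᵇ n) ≡ true → m ≡ n
≡ᵇ-true {m} {n} p = ≡ᵇ⇒≡ m n (subst T (sym p) _)

≢⇒≡ᵇ-false : ∀ {m n} → m ≢ n → (m ≡ᵇ n) ≡ false
≢⇒≡ᵇ-false m≢n = Bool.¬-not (m≢n ∘ ≡ᵇ-true)

≡ᵇ-refl : ∀ n → (n ≡ᵇ n) ≡ true
≡ᵇ-refl zero    = refl
≡ᵇ-refl (suc n) = ≡ᵇ-refl n

infixl 9 _!_

-- A subset of Fin n as an indicator function on ℕ, false from n on.
_!_ : ∀ {n} → Subset n → ℕ → Bool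
[]      ! _     = false
(x ∷ _) ! zero  = x
(_ ∷ F) ! suc i = F ! i

∈⇒! : ∀ {n} {F : Subset n} {v} → v ∈ F → F ! toℕ v ≡ true
∈⇒! here      = refl
∈⇒! (there p) = ∈⇒! p

!⇒∈ : ∀ {n} (F : Subset n) v → F ! toℕ v ≡ true → v ∈ F
!⇒∈ (true ∷ F) zero    refl = here
!⇒∈ (_ ∷ F)    (suc v) p    = there (!⇒∈ F v p)

∉⇔!≡false : ∀ {n} (F : Subset n) v → v ∉ F ⇔ F ! toℕ v ≡ false
∉⇔!≡false F v = mk⇔ (λ v∉F → Bool.¬-not (v∉F ∘ !⇒∈ F v))
                    (λ F!v≡false v∈F → Bool.not-¬ (∈⇒! v∈F) F!v≡false)

count∩ : ∀ {n} → Subset n → (ℕ → Bool) → ℕ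
count∩ []      g = 0
count∩ (x ∷ F) g = bit (x ∧ g 0) + count∩ F (g ∘ suc)

∣∩tabulate∣≡count∩ : ∀ {n} (F : Subset n) (g : ℕ → Bool) →
                      ∣ F ∩ tabulate (g ∘ toℕ) ∣ ≡ count∩ F g
∣∩tabulate∣≡count∩ []      g = refl
∣∩tabulate∣≡count∩ (x ∷ F) g with x ∧ g 0
... | true  = cong suc (∣∩tabulate∣≡count∩ F (g ∘ suc))
... | false = ∣∩tabulate∣≡count∩ F (g ∘ suc)

count∩-cong : ∀ {n} (F : Subset n) {g h : ℕ → Bool} → (∀ w → g w ≡ h w) →
               count∩ F g ≡ count∩ F h
count∩-cong []      g≗h = refl
count∩-cong (x ∷ F) g≗h =
  cong₂ (λ b m → bit (x ∧ b) + m) (g≗h 0) (count∩-cong F (g≗h ∘ suc))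

count∩-false : ∀ {n} (F : Subset n) → count∩ F (λ _ → false) ≡ 0
count∩-false []      = refl
count∩-false (x ∷ F) rewrite Bool.∧-zeroʳ x = count∩-false F

count∩-∨ : ∀ {n} (F : Subset n) {g h : ℕ → Bool} → (∀ w → g w ∧ h w ≡ false) →
            count∩ F (λ w → g w ∨ h w) ≡ count∩ F g + count∩ F h
count∩-∨ []      disjoint = refl
count∩-∨ (x ∷ F) {g} {h} disjoint = begin
  bit (x ∧ (g 0 ∨ h 0)) + count∩ F (λ w → g (suc w) ∨ h (suc w))
    ≡⟨ cong₂ _+_ (cong bit (Bool.∧-distribˡ-∨ x (g 0) (h 0))) (count∩-∨ F (disjoint ∘ suc)) ⟩
  bit ((x ∧ g 0) ∨ (x ∧ h 0)) + (count∩ F (g ∘ suc) + count∩ F (h ∘ suc))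
    ≡⟨ cong (_+ _) (bit-∨ (x ∧ g 0) (x ∧ h 0) (∧-disjoint x (disjoint 0))) ⟩
  (bit (x ∧ g 0) + bit (x ∧ h 0)) + (count∩ F (g ∘ suc) + count∩ F (h ∘ suc))
    ≡⟨ +-interchange (bit (x ∧ g 0)) (bit (x ∧ h 0)) _ _ ⟩
  (bit (x ∧ g 0) + count∩ F (g ∘ suc)) + (bit (x ∧ h 0) + count∩ F (h ∘ suc)) ∎
  where
  bit-∨ : ∀ a b → a ∧ b ≡ false → bit (a ∨ b) ≡ bit a + bit b
  bit-∨ true  false _ = refl
  bit-∨ false _     _ = refl
  ∧-disjoint : ∀ x {a b} → a ∧ b ≡ false → (x ∧ a) ∧ (x ∧ b) ≡ false
  ∧-disjoint false _  = refl
  ∧-disjoint true  ab = ab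

count∩-≡ᵇ : ∀ {n} (F : Subset n) p → count∩ F (p ≡ᵇ_) ≡ bit (F ! p)
count∩-≡ᵇ []      p       = refl
count∩-≡ᵇ (x ∷ F) zero    rewrite Bool.∧-identityʳ x | count∩-false F = +-identityʳ (bit x)
count∩-≡ᵇ (x ∷ F) (suc p) rewrite Bool.∧-zeroʳ x = count∩-≡ᵇ F p

-- the adjacency test used by edgeGraph
joins : ℕ → ℕ → ℕ × ℕ → Bool
joins a w e = ((proj₁ e ≡ᵇ a) ∧ (proj₂ e ≡ᵇ w)) ∨ ((proj₁ e ≡ᵇ w) ∧ (proj₂ e ≡ᵇ a))

nbrWeight : (ℕ → Bool) → ℕ → ℕ × ℕ → ℕ
nbrWeight f a (u , v) = if u ≡ᵇ a then bit (f v) else if v ≡ᵇ a then bit (f u) else 0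

nbrCount : (ℕ → Bool) → ℕ → List (ℕ × ℕ) → ℕ
nbrCount f a []       = 0
nbrCount f a (e ∷ es) = nbrWeight f a e + nbrCount f a es

nbrCount-++ : ∀ f a es es′ → nbrCount f a (es ++ₗ es′) ≡ nbrCount f a es + nbrCount f a es′
nbrCount-++ f a []       es′ = refl
nbrCount-++ f a (e ∷ es) es′ =
  trans (cong (nbrWeight f a e +_) (nbrCount-++ f a es es′)) (sym (+-assoc (nbrWeight f a e) _ _))

nbrWeight-fst : ∀ f u v → nbrWeight f u (u , v) ≡ bit (f v)
nbrWeight-fst f u v rewrite ≡ᵇ-refl u = refl

nbrWeight-snd : ∀ f {u v} → u ≢ v → nbrWeight f v (u , v) ≡ bit (f u)
nbrWeight-snd f {u} {v} u≢v rewrite ≢⇒≡ᵇ-false u≢v | ≡ᵇ-refl v = refl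

nbrWeight-off : ∀ f {a u v} → u ≢ a → v ≢ a → nbrWeight f a (u , v) ≡ 0
nbrWeight-off f u≢a v≢a rewrite ≢⇒≡ᵇ-false u≢a | ≢⇒≡ᵇ-false v≢a = refl

-- An ascending edge list lists no edge twice, which is what makes neighbour counts additive.
Ascending : ℕ → List (ℕ × ℕ) → ℕ → Set
Ascending lo []             hi = lo ≤ hi
Ascending lo ((u , v) ∷ es) hi = u < v × lo < v × Ascending v es hi

Ascending-weaken : ∀ {a b es c} → a ≤ b → Ascending b es c → Ascending a es c
Ascending-weaken {es = []}          a≤b b≤c               = ≤-trans a≤b b≤c
Ascending-weaken {es = (u , v) ∷ _} a≤b (u<v , b<v , asc) = u<v , ≤-<-trans a≤b b<v , asc

Ascending-++ : ∀ {a es b es′ c} → Ascending a es b → Ascending b es′ c → Ascending a (es ++ₗ es′) c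
Ascending-++ {es = []}          a≤b               asc′ = Ascending-weaken a≤b asc′
Ascending-++ {es = (u , v) ∷ _} (u<v , a<v , asc) asc′ = u<v , a<v , Ascending-++ asc asc′

joins-ends : ∀ a w u v → joins a w (u , v) ≡ true → (u ≡ a × v ≡ w) ⊎ (u ≡ w × v ≡ a)
joins-ends a w u v p with u ≡ᵇ a in ua | v ≡ᵇ w in vw | u ≡ᵇ w in uw | v ≡ᵇ a in va
... | true  | true  | _    | _    = inj₁ (≡ᵇ-true ua , ≡ᵇ-true vw)
... | true  | false | true | true = inj₂ (≡ᵇ-true uw , ≡ᵇ-true va)
... | false | _     | true | true = inj₂ (≡ᵇ-true uw , ≡ᵇ-true va)

-- both edges are {a, w}, and u < v pins down which end is which
joins-unique : ∀ {a w u v u′ v′} → u < v → u′ < v′ →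
               joins a w (u , v) ≡ true → joins a w (u′ , v′) ≡ true → v ≡ v′
joins-unique {a} {w} {u} {v} {u′} {v′} u<v u′<v′ p q
  with joins-ends a w u v p | joins-ends a w u′ v′ q
... | inj₁ (refl , refl) | inj₁ (refl , refl) = refl
... | inj₁ (refl , refl) | inj₂ (refl , refl) = ⊥-elim (<-asym u<v u′<v′)
... | inj₂ (refl , refl) | inj₁ (refl , refl) = ⊥-elim (<-asym u<v u′<v′)
... | inj₂ (refl , refl) | inj₂ (refl , refl) = refl

joins-later-edge : ∀ {lo es hi} → Ascending lo es hi → ∀ {a w u v} → u < v → v ≤ lo →
                   joins a w (u , v) ≡ true → any (joins a w) es ≡ false
joins-later-edge {es = []} _ _ _ _ = refl
joins-later-edge {es = (u′ , v′) ∷ es} (u′<v′ , lo<v′ , asc) {a} {w} u<v v≤lo p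
  with joins a w (u′ , v′) in q
... | true  = ⊥-elim (<-irrefl (joins-unique u<v u′<v′ p q) (≤-<-trans v≤lo lo<v′))
... | false = joins-later-edge asc u<v (≤-trans v≤lo (<⇒≤ lo<v′)) p

count∩-joins : ∀ {n} (F : Subset n) {a u v} → u < v →
               count∩ F (λ w → joins a w (u , v)) ≡ nbrWeight (F !_) a (u , v)
count∩-joins F {a} {u} {v} u<v with u ≡ᵇ a in ua | v ≡ᵇ a in va
... | true  | true  = ⊥-elim (<-irrefl (trans (≡ᵇ-true ua) (sym (≡ᵇ-true va))) u<v)
... | true  | false = trans (count∩-cong F (λ w → trans (cong ((v ≡ᵇ w) ∨_) (Bool.∧-zeroʳ (u ≡ᵇ w)))
                                                        (Bool.∨-identityʳ _)))
                           (count∩-≡ᵇ F v)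
... | false | true  = trans (count∩-cong F (λ w → Bool.∧-identityʳ (u ≡ᵇ w))) (count∩-≡ᵇ F u)
... | false | false = trans (count∩-cong F (λ w → Bool.∧-zeroʳ (u ≡ᵇ w))) (count∩-false F)

∣∩N∣≡nbrCount : ∀ {n lo es hi} → Ascending lo es hi → (F : Subset n) (v : Fin n) →
                ∣ F ∩ N (edgeGraph n es) v ∣ ≡ nbrCount (F !_) (toℕ v) es
∣∩N∣≡nbrCount asc F v = trans (∣∩tabulate∣≡count∩ F _) (go asc)
  where
  go : ∀ {lo es hi} → Ascending lo es hi →
       count∩ F (λ w → any (joins (toℕ v) w) es) ≡ nbrCount (F !_) (toℕ v) es
  go {es = []} _ = count∩-false F
  go {es = (u , w) ∷ es} (u<w , _ , asc) =
    trans (count∩-∨ F disjoint) (cong₂ _+_ (count∩-joins F u<w) (go asc))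
    where
    disjoint : ∀ x → joins (toℕ v) x (u , w) ∧ any (joins (toℕ v) x) es ≡ false
    disjoint x with joins (toℕ v) x (u , w) in p
    ... | true  = joins-later-edge asc u<w ≤-refl p
    ... | false = refl

FortOn : List (ℕ × ℕ) → (ℕ → Bool) → ℕ → ℕ → Set
FortOn es f o m = ∀ i → i < m → f (o + i) ≡ false → nbrCount f (o + i) es ≢ 1

isFort⇔FortOn : ∀ {n lo es hi} → Ascending lo es hi → (F : Subset n) →
                IsFort (edgeGraph n es) F ⇔ (Nonempty F × FortOn es (F !_) 0 n)
isFort⇔FortOn {n} {es = es} asc F = mk⇔
  (λ (ne , h) → ne , λ i i<n F!i≡false →
     subst (λ j → F ! j ≡ false → nbrCount (F !_) j es ≢ 1) (Fin.toℕ-fromℕ< i<n)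
           (λ out → subst (_≢ 1) (∣∩N∣≡nbrCount asc F _)
                          (h _ (Equivalence.from (∉⇔!≡false F _) out)))
           F!i≡false)
  (λ (ne , h) → ne , λ v v∉F →
     subst (_≢ 1) (sym (∣∩N∣≡nbrCount asc F v))
           (h (toℕ v) (Fin.toℕ<n v) (Equivalence.to (∉⇔!≡false F v) v∉F)))

FortOn-+ : ∀ es f o m m′ → FortOn es f o (m + m′) ⇔ (FortOn es f o m × FortOn es f (o + m) m′)
FortOn-+ es f o m m′ = mk⇔
  (λ h → (λ i i<m → h i (≤-trans i<m (m≤m+n m m′))) ,
         (λ i i<m′ → shift i (h (m + i) (+-monoʳ-< m i<m′))))
  (λ (h₁ , h₂) i i<m+m′ → split i i<m+m′ h₁ h₂)
  where
  Good : ℕ → Set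
  Good j = f j ≡ false → nbrCount f j es ≢ 1
  shift : ∀ i → Good (o + (m + i)) → Good (o + m + i)
  shift i = subst Good (sym (+-assoc o m i))
  split : ∀ i → i < m + m′ → FortOn es f o m → FortOn es f (o + m) m′ → Good (o + i)
  split i i<m+m′ h₁ h₂ with i <? m
  ... | yes i<m = h₁ i i<m
  ... | no  i≮m = subst (λ j → Good (o + j)) (m+[n∸m]≡n m≤i)
                    (subst Good (+-assoc o m (i ∸ m))
                      (h₂ (i ∸ m) (+-cancelˡ-< m _ _ (subst (_< m + m′) (sym (m+[n∸m]≡n m≤i)) i<m+m′))))
    where m≤i = ≮⇒≥ i≮m

FortOn-cong : ∀ {es es′ f p m} → (∀ i → i < m → nbrCount f (p + i) es ≡ nbrCount f (p + i) es′) →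
              FortOn es f p m ⇔ FortOn es′ f p m
FortOn-cong eq = mk⇔ (λ h i i<m out → subst (_≢ 1) (eq i i<m) (h i i<m out))
                     (λ h i i<m out → subst (_≢ 1) (sym (eq i i<m)) (h i i<m out))

-- Paths and legs

chain : ℕ → ℕ → List (ℕ × ℕ)
chain p zero    = []
chain p (suc y) = (p , suc p) ∷ chain (suc p) y

-- the leg with vertices o + 1, …, o + x hanging off vertex 0
leg : ℕ → ℕ → List (ℕ × ℕ)
leg o zero    = []
leg o (suc y) = (0 , suc o) ∷ chain (suc o) y

chain-snoc : ∀ p y → chain p (suc y) ≡ chain p y ++ₗ [ (p + y , suc (p + y)) ]
chain-snoc p zero    rewrite +-identityʳ p = refl
chain-snoc p (suc y) rewrite +-suc p y = cong ((p , suc p) ∷_) (chain-snoc (suc p) y)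

pathEdges≡chain : ∀ y → pathEdges (suc y) ≡ chain 0 y
pathEdges≡chain zero          = refl
pathEdges≡chain (suc zero)    = refl
pathEdges≡chain (suc (suc y)) =
  trans (cong (_++ₗ [ (suc y , suc (suc y)) ]) (pathEdges≡chain (suc y))) (sym (chain-snoc 0 (suc y)))

legEdges≡leg : ∀ o x → legEdges o x ≡ leg o x
legEdges≡leg o zero          = refl
legEdges≡leg o (suc zero)    = refl
legEdges≡leg o (suc (suc y))
  rewrite legEdges≡leg o (suc y) | chain-snoc (suc o) y | +-suc o (suc y) | +-suc o y = refl

Ascending-chain : ∀ p y → Ascending p (chain p y) (p + y)
Ascending-chain p zero    = m≤m+n p 0
Ascending-chain p (suc y) rewrite +-suc p y = n<1+n p , n<1+n p , Ascending-chain (suc p) y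

Ascending-leg : ∀ o x → Ascending o (leg o x) (o + x)
Ascending-leg o zero    = m≤m+n o 0
Ascending-leg o (suc y) rewrite +-suc o y = s≤s z≤n , n<1+n o , Ascending-chain (suc o) y

Ascending-spiderEdges : ∀ o ls → Ascending o (spiderEdges o ls) (o + sum ls)
Ascending-spiderEdges o []       = m≤m+n o 0
Ascending-spiderEdges o (x ∷ xs) rewrite legEdges≡leg o x | sym (+-assoc o x (sum xs)) =
  Ascending-++ (Ascending-leg o x) (Ascending-spiderEdges (o + x) xs)

Agrees : ∀ {m} → (ℕ → Bool) → ℕ → Subset m → Set
Agrees {m} f p s = ∀ j → j < m → f (p + j) ≡ s ! j

chain-below : ∀ f {a p} y → a < p → nbrCount f a (chain p y) ≡ 0
chain-below f zero    a<p = refl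
chain-below f (suc y) a<p =
  cong₂ _+_ (nbrWeight-off f (>⇒≢ a<p) (>⇒≢ (m<n⇒m<1+n a<p))) (chain-below f y (m<n⇒m<1+n a<p))

chain-above : ∀ f {a p} y → p + y < a → nbrCount f a (chain p y) ≡ 0
chain-above f         zero    _         = refl
chain-above f {a} {p} (suc y) p+1+y<a =
  cong₂ _+_ (nbrWeight-off f (<⇒≢ (<-trans (n<1+n p) 1+p<a)) (<⇒≢ 1+p<a)) (chain-above f y 1+p+y<a)
  where
  1+p+y<a : suc p + y < a
  1+p+y<a = subst (_< a) (+-suc p y) p+1+y<a
  1+p<a : suc p < a
  1+p<a = ≤-<-trans (s≤s (m≤m+n p y)) 1+p+y<a

bit-cons : ∀ {n} c (s : Subset n) i → bit ((c ∷ []) ! i) + bit ((false ∷ s) ! i) ≡ bit ((c ∷ s) ! i)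
bit-cons c s zero    = +-identityʳ (bit c)
bit-cons c s (suc i) = refl

-- (false ∷ t) ! i is the predecessor of vertex p + i (none for i = 0), t ! suc i its successor
-- (none for i = y).
chain-inner : ∀ f p y (t : Subset (suc y)) → Agrees f p t →
              ∀ i → i ≤ y → nbrCount f (p + i) (chain p y) ≡ bit ((false ∷ t) ! i) + bit (t ! suc i)
chain-inner f p zero    (_ ∷ []) _   zero    _ = refl
chain-inner f p (suc y) (x ∷ t)  agr zero    _ rewrite +-identityʳ p = begin
  nbrWeight f p (p , suc p) + nbrCount f p (chain (suc p) y)
    ≡⟨ cong₂ _+_ (nbrWeight-fst f p (suc p)) (chain-below f y (n<1+n p)) ⟩
  bit (f (suc p)) + 0
    ≡⟨ trans (+-identityʳ _) (cong bit (trans (cong f (+-comm 1 p)) (agr 1 (s≤s (s≤s z≤n))))) ⟩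
  bit (t ! 0) ∎
chain-inner f p (suc y) (x ∷ t)  agr (suc i) (s≤s i≤y) rewrite +-suc p i = begin
  nbrWeight f (suc (p + i)) (p , suc p) + nbrCount f (suc p + i) (chain (suc p) y)
    ≡⟨ cong₂ _+_ (first-edge i) (chain-inner f (suc p) y t agr′ i i≤y) ⟩
  bit ((x ∷ []) ! i) + (bit ((false ∷ t) ! i) + bit (t ! suc i))
    ≡⟨ trans (sym (+-assoc (bit ((x ∷ []) ! i)) _ _)) (cong (_+ bit (t ! suc i)) (bit-cons x t i)) ⟩
  bit ((x ∷ t) ! i) + bit (t ! suc i) ∎
  where
  agr′ : Agrees f (suc p) t
  agr′ j j<1+y = trans (cong f (sym (+-suc p j))) (agr (suc j) (s≤s j<1+y))
  first-edge : ∀ i → nbrWeight f (suc (p + i)) (p , suc p) ≡ bit ((x ∷ []) ! i)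
  first-edge zero    rewrite +-identityʳ p =
    trans (nbrWeight-snd f (<⇒≢ (n<1+n p))) (cong bit (trans (cong f (sym (+-identityʳ p))) (agr 0 (s≤s z≤n))))
  first-edge (suc i) = nbrWeight-off f (m≢1+m+n p) (λ eq → m≢1+m+n p (trans (suc-injective eq) (+-suc p i)))

first : ∀ {n} → Subset n → Bool
first []      = false
first (x ∷ _) = x

leg-junction : ∀ f o {x} (s : Subset x) → Agrees f (suc o) s → nbrCount f 0 (leg o x) ≡ bit (first s)
leg-junction f o []      agr = refl
leg-junction f o {suc y} (b ∷ s) agr = begin
  nbrWeight f 0 (0 , suc o) + nbrCount f 0 (chain (suc o) y)
    ≡⟨ cong₂ _+_ (nbrWeight-fst f 0 (suc o)) (chain-below f y (s≤s z≤n)) ⟩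
  bit (f (suc o)) + 0
    ≡⟨ trans (+-identityʳ _) (cong bit (trans (cong (f ∘ suc) (sym (+-identityʳ o))) (agr 0 (s≤s z≤n)))) ⟩
  bit b ∎

leg-below : ∀ f {a} o x → 0 < a → a ≤ o → nbrCount f a (leg o x) ≡ 0
leg-below f o zero    _   _   = refl
leg-below f o (suc y) 0<a a≤o =
  cong₂ _+_ (nbrWeight-off f (<⇒≢ 0<a) (>⇒≢ (s≤s a≤o))) (chain-below f y (s≤s a≤o))

leg-above : ∀ f {a} o x → o + x < a → nbrCount f a (leg o x) ≡ 0
leg-above f     o zero    _       = refl
leg-above f {a} o (suc y) o+x<a =
  cong₂ _+_ (nbrWeight-off f (<⇒≢ (≤-<-trans z≤n 1+o<a)) (<⇒≢ 1+o<a)) (chain-above f y 1+o+y<a)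
  where
  1+o+y<a : suc o + y < a
  1+o+y<a = subst (_< a) (+-suc o y) o+x<a
  1+o<a : suc o < a
  1+o<a = ≤-<-trans (s≤s (m≤m+n o y)) 1+o+y<a

leg-inner : ∀ f o {x} (s : Subset x) c → f 0 ≡ c → Agrees f (suc o) s →
            ∀ i → i < x → nbrCount f (suc o + i) (leg o x) ≡ bit ((c ∷ s) ! i) + bit (s ! suc i)
leg-inner f o {suc y} s c f0≡c agr i (s≤s i≤y) = begin
  nbrWeight f (suc o + i) (0 , suc o) + nbrCount f (suc o + i) (chain (suc o) y)
    ≡⟨ cong₂ _+_ (junction-edge i) (chain-inner f (suc o) y s agr i i≤y) ⟩
  bit ((c ∷ []) ! i) + (bit ((false ∷ s) ! i) + bit (s ! suc i))
    ≡⟨ trans (sym (+-assoc (bit ((c ∷ []) ! i)) _ _)) (cong (_+ bit (s ! suc i)) (bit-cons c s i)) ⟩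
  bit ((c ∷ s) ! i) + bit (s ! suc i) ∎
  where
  junction-edge : ∀ i → nbrWeight f (suc o + i) (0 , suc o) ≡ bit ((c ∷ []) ! i)
  junction-edge zero    rewrite +-identityʳ o = trans (nbrWeight-snd f {0} {suc o} (λ ())) (cong bit f0≡c)
  junction-edge (suc i) =
    nbrWeight-off f {u = 0} (λ ()) (λ eq → m≢1+m+n o (trans (suc-injective eq) (+-suc o i)))

-- c is the membership of the vertex the leg hangs off; each vertex outside s must have neighbours
-- of equal membership.
legFortᵇ : ∀ {n} → Bool → Subset n → Bool
legFortᵇ c []      = true
legFortᵇ c (x ∷ s) = (x ∨ not (c xor first s)) ∧ legFortᵇ x s

LegFort : ∀ {n} → Bool → Subset n → Set
LegFort {n} c s = ∀ i → i < n → s ! i ≡ false → bit ((c ∷ s) ! i) + bit (s ! suc i) ≢ 1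

!0≡first : ∀ {n} (s : Subset n) → s ! 0 ≡ first s
!0≡first []      = refl
!0≡first (_ ∷ _) = refl

outside⇔agree : ∀ x c h → (x ≡ false → bit c + bit h ≢ 1) ⇔ T (x ∨ not (c xor h))
outside⇔agree true  c     h     = mk⇔ _ (λ _ ())
outside⇔agree false true  true  = mk⇔ _ (λ _ _ ())
outside⇔agree false true  false = mk⇔ (λ h → h refl refl) λ ()
outside⇔agree false false true  = mk⇔ (λ h → h refl refl) λ ()
outside⇔agree false false false = mk⇔ _ (λ _ _ ())

LegFort⇔legFortᵇ : ∀ {n} c (s : Subset n) → LegFort c s ⇔ T (legFortᵇ c s)
LegFort⇔legFortᵇ c []      = mk⇔ _ (λ _ _ ())
LegFort⇔legFortᵇ c (x ∷ s) = mk⇔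
  (λ h → Equivalence.from Bool.T-∧
           ( Equivalence.to (outside⇔agree x c (first s))
               (λ x≡false → subst (λ b → bit c + bit b ≢ 1) (!0≡first s) (h 0 (s≤s z≤n) x≡false))
           , Equivalence.to (LegFort⇔legFortᵇ x s) (λ i i<n → h (suc i) (s≤s i<n))))
  (λ t → let (t₀ , tₛ) = Equivalence.to Bool.T-∧ t in
     λ { zero    _          x≡false → subst (λ b → bit c + bit b ≢ 1) (sym (!0≡first s))
                                        (Equivalence.from (outside⇔agree x c (first s)) t₀ x≡false)
       ; (suc i) (s≤s i<n) → Equivalence.from (LegFort⇔legFortᵇ x s) tₛ i i<n })

FortOn-leg⇔ : ∀ {es f p c n} (s : Subset n) → Agrees f p s →
              (∀ i → i < n → nbrCount f (p + i) es ≡ bit ((c ∷ s) ! i) + bit (s ! suc i)) →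
              FortOn es f p n ⇔ T (legFortᵇ c s)
FortOn-leg⇔ {c = c} s agr count = ⇔-trans
  (mk⇔ (λ h i i<n s!i≡false → subst (_≢ 1) (count i i<n) (h i i<n (trans (agr i i<n) s!i≡false)))
       (λ h i i<n f≡false → subst (_≢ 1) (sym (count i i<n)) (h i i<n (trans (sym (agr i i<n)) f≡false))))
  (LegFort⇔legFortᵇ c s)

-- P n behaves as a leg hanging off a vertex outside F.
pathFort⇔ : ∀ {n} (F : Subset n) → IsFort (P n) F ⇔ (Nonempty F × T (legFortᵇ false F))
pathFort⇔ []          = mk⇔ (λ { ((() , _) , _) }) (λ { ((() , _) , _) })
pathFort⇔ {suc y} F = subst (λ es → IsFort (edgeGraph (suc y) es) F ⇔ (Nonempty F × T (legFortᵇ false F)))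
                            (sym (pathEdges≡chain y)) $
  ⇔-trans (isFort⇔FortOn (Ascending-chain 0 y) F)
          (⇔-refl ×-⇔ FortOn-leg⇔ {es = chain 0 y} {F !_} {0} F (λ _ _ → refl)
                                   (λ i i<n → chain-inner (F !_) 0 y F (λ _ _ → refl) i (m<1+n⇒m≤n i<n)))

-- Forts of the spider

spider : List ℕ → Graph
spider ls = edgeGraph (suc (sum ls)) (spiderEdges 0 ls)

-- a subset of the non-junction vertices of spider ls, cut into its legs
Legs : List ℕ → Set
Legs = All Subset

join : ∀ {ls} → Legs ls → Subset (sum ls)
join []       = []
join (s ∷ ss) = s ++ join ss

legsOf : ∀ ls → Subset (sum ls) → Legs ls
legsOf []       S = []
legsOf (x ∷ xs) S = take x S ∷ legsOf xs (drop x S)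

take-++ : ∀ {m n} (s : Subset m) (t : Subset n) → take m (s ++ t) ≡ s
take-++ []      t = refl
take-++ (x ∷ s) t = cong (x ∷_) (take-++ s t)

drop-++ : ∀ {m n} (s : Subset m) (t : Subset n) → drop m (s ++ t) ≡ t
drop-++ []      t = refl
drop-++ (x ∷ s) t = drop-++ s t

join-legsOf : ∀ ls (S : Subset (sum ls)) → join (legsOf ls S) ≡ S
join-legsOf []       [] = refl
join-legsOf (x ∷ xs) S = trans (cong (take x S ++_) (join-legsOf xs (drop x S))) (Vec.take++drop≡id x S)

legsOf-join : ∀ {ls} (ss : Legs ls) → legsOf ls (join ss) ≡ ss
legsOf-join []       = refl
legsOf-join (s ∷ ss) =
  cong₂ _∷_ (take-++ s (join ss)) (trans (cong (legsOf _) (drop-++ s (join ss))) (legsOf-join ss))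

spider-subset-elim : ∀ {ls} {Q : Subset (suc (sum ls)) → Set} →
                     (∀ c (ss : Legs ls) → Q (c ∷ join ss)) → ∀ F → Q F
spider-subset-elim {ls} {Q} q (c ∷ S) = subst (Q ∘ (c ∷_)) (join-legsOf ls S) (q c (legsOf ls S))

firstCount : ∀ {ls} → Legs ls → ℕ
firstCount []       = 0
firstCount (s ∷ ss) = bit (first s) + firstCount ss

Every : (∀ {x} → Subset x → Set) → ∀ {ls} → Legs ls → Set
Every P []       = ⊤
Every P (s ∷ ss) = P s × Every P ss

LegsFort : Bool → ∀ {ls} → Legs ls → Set
LegsFort c = Every (T ∘ legFortᵇ c)

Every-map : ∀ {P Q : ∀ {x} → Subset x → Set} → (∀ {x} {s : Subset x} → P s → Q s) →
            ∀ {ls} {ss : Legs ls} → Every P ss → Every Q ss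
Every-map f {ss = []}     _        = _
Every-map f {ss = s ∷ ss} (p , ps) = f p , Every-map f ps

Every-⇔ : ∀ {P Q : ∀ {x} → Subset x → Set} → (∀ {x} (s : Subset x) → P s ⇔ Q s) →
          ∀ {ls} (ss : Legs ls) → Every P ss ⇔ Every Q ss
Every-⇔ P⇔Q ss = mk⇔ (Every-map (Equivalence.to (P⇔Q _))) (Every-map (Equivalence.from (P⇔Q _)))

!-++ˡ : ∀ {m n} (s : Subset m) (t : Subset n) {j} → j < m → (s ++ t) ! j ≡ s ! j
!-++ˡ (x ∷ s) t {zero}  _         = refl
!-++ˡ (x ∷ s) t {suc j} (s≤s j<m) = !-++ˡ s t j<m

!-++ʳ : ∀ {m n} (s : Subset m) (t : Subset n) j → (s ++ t) ! (m + j) ≡ t ! j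
!-++ʳ []      t j = refl
!-++ʳ (x ∷ s) t j = !-++ʳ s t j

Agrees-++ : ∀ f p {m n} (s : Subset m) (t : Subset n) → Agrees f p (s ++ t) → Agrees f p s × Agrees f (p + m) t
Agrees-++ f p {m} {n} s t agr =
  (λ j j<m → trans (agr j (≤-trans j<m (m≤m+n m n))) (!-++ˡ s t j<m)) ,
  (λ j j<n → trans (cong f (+-assoc p m j)) (trans (agr (m + j) (+-monoʳ-< m j<n)) (!-++ʳ s t j)))

nbrCount-spiderEdges : ∀ f a o x xs →
  nbrCount f a (spiderEdges o (x ∷ xs)) ≡ nbrCount f a (leg o x) + nbrCount f a (spiderEdges (o + x) xs)
nbrCount-spiderEdges f a o x xs rewrite sym (legEdges≡leg o x) = nbrCount-++ f a (legEdges o x) _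

spider-junction : ∀ f o {ls} (ss : Legs ls) → Agrees f (suc o) (join ss) →
                  nbrCount f 0 (spiderEdges o ls) ≡ firstCount ss
spider-junction f o []                agr = refl
spider-junction f o {x ∷ xs} (s ∷ ss) agr =
  let (agrₛ , agrₛₛ) = Agrees-++ f (suc o) s (join ss) agr in
  trans (nbrCount-spiderEdges f 0 o x xs)
        (cong₂ _+_ (leg-junction f o s agrₛ) (spider-junction f (o + x) ss agrₛₛ))

spider-below : ∀ f {a} o ls → 0 < a → a ≤ o → nbrCount f a (spiderEdges o ls) ≡ 0
spider-below f o []       _   _   = refl
spider-below f o (x ∷ xs) 0<a a≤o =
  trans (nbrCount-spiderEdges f _ o x xs)
        (cong₂ _+_ (leg-below f o x 0<a a≤o) (spider-below f (o + x) xs 0<a (≤-trans a≤o (m≤m+n o x))))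

spider-legs⇔ : ∀ f c o {ls} (ss : Legs ls) → f 0 ≡ c → Agrees f (suc o) (join ss) →
               FortOn (spiderEdges o ls) f (suc o) (sum ls) ⇔ LegsFort c ss
spider-legs⇔ f c o []                _    _   = mk⇔ _ (λ _ _ ())
spider-legs⇔ f c o {x ∷ xs} (s ∷ ss) f0≡c agr =
  let (agrₛ , agrₛₛ) = Agrees-++ f (suc o) s (join ss) agr in
  ⇔-trans (FortOn-+ E f (suc o) x (sum xs))
          (FortOn-leg⇔ {es = E} s agrₛ (inner agrₛ)
           ×-⇔ ⇔-trans (FortOn-cong {es = E} {es′ = spiderEdges (o + x) xs} beyond)
                       (spider-legs⇔ f c (o + x) ss f0≡c agrₛₛ))
  where
  E = spiderEdges o (x ∷ xs)
  inner : Agrees f (suc o) s → ∀ i → i < x →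
          nbrCount f (suc o + i) (spiderEdges o (x ∷ xs)) ≡ bit ((c ∷ s) ! i) + bit (s ! suc i)
  inner agrₛ i i<x = begin
    nbrCount f (suc o + i) (spiderEdges o (x ∷ xs))
      ≡⟨ nbrCount-spiderEdges f _ o x xs ⟩
    nbrCount f (suc o + i) (leg o x) + nbrCount f (suc o + i) (spiderEdges (o + x) xs)
      ≡⟨ cong₂ _+_ (leg-inner f o s c f0≡c agrₛ i i<x)
                   (spider-below f (o + x) xs (s≤s z≤n) (subst (_≤ o + x) (+-suc o i) (+-monoʳ-≤ o i<x))) ⟩
    bit ((c ∷ s) ! i) + bit (s ! suc i) + 0
      ≡⟨ +-identityʳ _ ⟩
    bit ((c ∷ s) ! i) + bit (s ! suc i) ∎
  beyond : ∀ i → i < sum xs → nbrCount f (suc o + x + i) (spiderEdges o (x ∷ xs))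
                             ≡ nbrCount f (suc o + x + i) (spiderEdges (o + x) xs)
  beyond i _ = trans (nbrCount-spiderEdges f _ o x xs)
                     (cong (_+ nbrCount f (suc o + x + i) (spiderEdges (o + x) xs))
                           (leg-above f o x (s≤s (m≤m+n (o + x) i))))

spiderFort⇔ : ∀ {ls} c (ss : Legs ls) → IsFort (spider ls) (c ∷ join ss) ⇔
              (Nonempty (c ∷ join ss) × (c ≡ false → firstCount ss ≢ 1) × LegsFort c ss)
spiderFort⇔ {ls} c ss =
  ⇔-trans (isFort⇔FortOn (Ascending-spiderEdges 0 ls) (c ∷ join ss))
          (⇔-refl ×-⇔ ⇔-trans (FortOn-+ (spiderEdges 0 ls) f 0 1 (sum ls))
                                (junction ×-⇔ spider-legs⇔ f c 0 ss refl (λ _ _ → refl)))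
  where
  f = (c ∷ join ss) !_
  junction : FortOn (spiderEdges 0 ls) f 0 1 ⇔ (c ≡ false → firstCount ss ≢ 1)
  junction = mk⇔ (λ h c≡false → subst (_≢ 1) count≡ (h 0 (s≤s z≤n) c≡false))
                 (λ { h zero _ c≡false → subst (_≢ 1) (sym count≡) (h c≡false) ; h (suc _) (s≤s ()) })
    where count≡ = spider-junction f 0 ss (λ _ _ → refl)

-- Subsets and minimality

Minimal : ∀ {n} → (Subset n → Set) → Subset n → Set
Minimal P s = P s × (∀ t → t ⊂ s → ¬ P t)

minimal-or-smaller : ∀ {n} {P : Subset n → Set} → Decidable P → ∀ {s} → P s →
                     Minimal P s ⊎ ∃ λ t → t ⊂ s × P t
minimal-or-smaller P? {s} ps with anySubset? (λ t → (t ⊂? s) ×-dec P? t)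
... | yes (t , t⊂s , pt) = inj₂ (t , t⊂s , pt)
... | no  ∄t             = inj₁ (ps , λ t t⊂s pt → ∄t (t , t⊂s , pt))

⊆∧≢⇒⊂ : ∀ {n} {p q : Subset n} → p ⊆ q → p ≢ q → p ⊂ q
⊆∧≢⇒⊂ {p = []}        {[]}        _   p≢q = ⊥-elim (p≢q refl)
⊆∧≢⇒⊂ {p = true ∷ p}  {true ∷ q}  p⊆q p≢q = s⊂s (⊆∧≢⇒⊂ (drop-∷-⊆ p⊆q) (p≢q ∘ cong (true ∷_)))
⊆∧≢⇒⊂ {p = false ∷ p} {false ∷ q} p⊆q p≢q = s⊂s (⊆∧≢⇒⊂ (drop-∷-⊆ p⊆q) (p≢q ∘ cong (false ∷_)))
⊆∧≢⇒⊂ {p = false ∷ p} {true ∷ q}  p⊆q _   = out⊂in (drop-∷-⊆ p⊆q)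
⊆∧≢⇒⊂ {p = true ∷ p}  {false ∷ q} p⊆q _   with p⊆q here
... | ()

minimal-⊆ : ∀ {n} {P : Subset n → Set} {s t} → Minimal P s → t ⊆ s → P t → t ≡ s
minimal-⊆ {s = s} {t} (_ , min) t⊆s pt with Vec.≡-dec Bool._≟_ t s
... | yes t≡s = t≡s
... | no  t≢s = ⊥-elim (min t (⊆∧≢⇒⊂ t⊆s t≢s) pt)

zero∈ : ∀ {m n} {x} {u : Subset m} {v : Subset n} → zero ∈ x ∷ u → zero ∈ x ∷ v
zero∈ here = here

zero∉false∷ : ∀ {n} {p : Subset n} → zero ∉ false ∷ p
zero∉false∷ ()

⊆-++ : ∀ {m n} {s′ s : Subset m} {t′ t : Subset n} → s′ ⊆ s → t′ ⊆ t → s′ ++ t′ ⊆ s ++ t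
⊆-++ {s′ = []}    {[]}    _    t′⊆t y∈         = t′⊆t y∈
⊆-++ {s′ = _ ∷ _} {_ ∷ _} s′⊆s t′⊆t here       = zero∈ (s′⊆s here)
⊆-++ {s′ = _ ∷ _} {_ ∷ _} s′⊆s t′⊆t (there y∈) = there (⊆-++ (drop-∷-⊆ s′⊆s) t′⊆t y∈)

⊆-++⁻ : ∀ {m n} (s′ s : Subset m) {t′ t : Subset n} → s′ ++ t′ ⊆ s ++ t → s′ ⊆ s × t′ ⊆ t
⊆-++⁻ []       []      h = (λ ()) , h
⊆-++⁻ (_ ∷ s′) (_ ∷ s) h =
  let (s′⊆s , t′⊆t) = ⊆-++⁻ s′ s (drop-∷-⊆ h) in
  (λ { here → zero∈ (h here) ; (there y∈) → there (s′⊆s y∈) }) , t′⊆t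

⊂-++ˡ : ∀ {m n} {s′ s : Subset m} (t : Subset n) → s′ ⊂ s → s′ ++ t ⊂ s ++ t
⊂-++ˡ {s′ = s′} {s} t s′⊂s@(s′⊆s , _) =
  ⊆∧≢⇒⊂ (⊆-++ s′⊆s ⊆-refl) (λ eq → ⊂-irref (Vec.++-injectiveˡ s′ s eq) s′⊂s)

⊂-++ʳ : ∀ {m n} (s : Subset m) {t′ t : Subset n} → t′ ⊂ t → s ++ t′ ⊂ s ++ t
⊂-++ʳ s t′⊂t@(t′⊆t , _) =
  ⊆∧≢⇒⊂ (⊆-++ (⊆-refl {x = s}) t′⊆t) (λ eq → ⊂-irref (Vec.++-injectiveʳ s s eq) t′⊂t)

T-does⇔ : ∀ {A : Set} (a? : Dec A) → T (does a?) ⇔ A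
T-does⇔ (yes a) = mk⇔ (λ _ → a) _
T-does⇔ (no ¬a) = mk⇔ (λ ()) ¬a

-- Forts along a single leg

Nonempty-tail : ∀ {n} {s : Subset n} → Nonempty (false ∷ s) → Nonempty s
Nonempty-tail (suc v , there v∈s) = v , v∈s

Nonempty-cons : ∀ {n} {s : Subset n} x → Nonempty s → Nonempty (x ∷ s)
Nonempty-cons x (v , v∈s) = suc v , there v∈s

Nonempty-++⁻ : ∀ {m n} (s : Subset m) {t : Subset n} → Nonempty (s ++ t) → Nonempty s ⊎ Nonempty t
Nonempty-++⁻ []      ne                = inj₂ ne
Nonempty-++⁻ (x ∷ s) (zero  , here)    = inj₁ (zero , here)
Nonempty-++⁻ (x ∷ s) (suc v , there p) = Sum.map₁ (Nonempty-cons x) (Nonempty-++⁻ s (v , p))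

Nonempty-++ʳ : ∀ {m n} (s : Subset m) {t : Subset n} → Nonempty t → Nonempty (s ++ t)
Nonempty-++ʳ []      ne = ne
Nonempty-++ʳ (x ∷ s) ne = Nonempty-cons x (Nonempty-++ʳ s ne)

first⇒Nonempty : ∀ {n} (s : Subset n) → T (first s) → Nonempty s
first⇒Nonempty (true ∷ s) _ = zero , here

first-⊥ : ∀ n → first (⊥ {n}) ≡ false
first-⊥ zero    = refl
first-⊥ (suc n) = refl

⊥⊂first : ∀ {n} (s : Subset n) → T (first s) → ⊥ ⊂ s
⊥⊂first (true ∷ s) _ = out⊂in ⊥⊆

first-mono : ∀ {n} {s′ s : Subset n} → s′ ⊆ s → bit (first s′) ≤ bit (first s)
first-mono {s′ = []}        _    = z≤n
first-mono {s′ = false ∷ _} _    = z≤n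
first-mono {s′ = true ∷ _}  s′⊆s with s′⊆s here
... | here = ≤-refl

legFort-false⇒first : ∀ {n} (s : Subset n) → T (legFortᵇ false s) → Nonempty s → T (first s)
legFort-false⇒first (true  ∷ s) _ _ = _
legFort-false⇒first (false ∷ s) l ne =
  let (first-out , l′) = Equivalence.to Bool.T-∧ l in
  ⊥-elim (subst T (Equivalence.to Bool.T-not-≡ first-out) (legFort-false⇒first s l′ (Nonempty-tail ne)))

pathFort⇔first : ∀ {n} (s : Subset n) → IsFort (P n) s ⇔ (T (first s) × T (legFortᵇ false s))
pathFort⇔first s = ⇔-trans (pathFort⇔ s)
  (mk⇔ (λ (ne , l) → legFort-false⇒first s l ne , l) (λ (f , l) → first⇒Nonempty s f , l))

pathFort⇒first : ∀ {n} (s : Subset n) → IsFort (P n) s → T (first s)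
pathFort⇒first s = proj₁ ∘ Equivalence.to (pathFort⇔first s)

pathFort⇒legFort : ∀ {n} (s : Subset n) → IsFort (P n) s → T (legFortᵇ false s)
pathFort⇒legFort s = proj₂ ∘ Equivalence.to (pathFort⇔first s)

legFort-false-⊥ : ∀ n → T (legFortᵇ false (⊥ {n}))
legFort-false-⊥ zero          = _
legFort-false-⊥ (suc zero)    = _
legFort-false-⊥ (suc (suc n)) = legFort-false-⊥ (suc n)

empty-or-pathFort : ∀ {n} (s : Subset n) → T (legFortᵇ false s) → s ≡ ⊥ ⊎ IsFort (P n) s
empty-or-pathFort s l with T? (first s)
... | yes f   = inj₂ (Equivalence.from (pathFort⇔first s) (f , l))
... | no  ¬f  = inj₁ (Empty-unique (¬f ∘ legFort-false⇒first s l))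

minPathFortᵇ : ∀ {n} → Subset n → Bool
minPathFortᵇ {n} s = does (isMinimalFort? (P n) s)

minPathFort⇔ : ∀ {n} (s : Subset n) → T (minPathFortᵇ s) ⇔ IsMinimalFort (P n) s
minPathFort⇔ {n} s = T-does⇔ (isMinimalFort? (P n) s)

-- true ∷ s is a fort of a path, minimal among those containing the end vertex. By minimalLeg⇔ these
-- are [], false ∷ m, true ∷ [] and true ∷ false ∷ m for the minimal forts m of the remaining path.
MinimalLeg : ∀ {n} → Subset n → Set
MinimalLeg = Minimal (T ∘ legFortᵇ true)

minLegOutᵇ : ∀ {n} → Subset n → Bool
minLegOutᵇ []          = true
minLegOutᵇ (true  ∷ _) = false
minLegOutᵇ (false ∷ t) = minPathFortᵇ t

minLegInᵇ : ∀ {n} → Subset n → Bool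
minLegInᵇ []                 = false
minLegInᵇ (false ∷ _)        = false
minLegInᵇ (true ∷ [])        = true
minLegInᵇ (true ∷ true  ∷ _) = false
minLegInᵇ (true ∷ false ∷ t) = minPathFortᵇ t

legFort-true-out⇔ : ∀ {n} (t : Subset n) → T (legFortᵇ true (false ∷ t)) ⇔ IsFort (P n) t
legFort-true-out⇔ t = ⇔-trans Bool.T-∧
  (⇔-trans (mk⇔ (λ (f , l) → subst T (Bool.not-involutive (first t)) f , l)
                (λ (f , l) → subst T (sym (Bool.not-involutive (first t))) f , l))
           (⇔-sym (pathFort⇔first t)))

minimalLeg-out⇔ : ∀ {n} (t : Subset n) → MinimalLeg (false ∷ t) ⇔ T (minPathFortᵇ t)
minimalLeg-out⇔ {n} t = ⇔-trans (mk⇔ to from) (⇔-sym (minPathFort⇔ t))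
  where
  to : MinimalLeg (false ∷ t) → IsMinimalFort (P n) t
  to (l , min) = Equivalence.to (legFort-true-out⇔ t) l , λ t′ t′⊂t f′ →
    min (false ∷ t′) (s⊂s t′⊂t) (Equivalence.from (legFort-true-out⇔ t′) f′)
  from : IsMinimalFort (P n) t → MinimalLeg (false ∷ t)
  from (f , min) = Equivalence.from (legFort-true-out⇔ t) f , λ
    { (false ∷ u) u⊂ l       → min u (drop-∷-⊂ u⊂) (Equivalence.to (legFort-true-out⇔ u) l)
    ; (true  ∷ u) (u⊆ , _) _ → zero∉false∷ (u⊆ here) }

minimalLeg-in⇔ : ∀ {n} (t : Subset n) → MinimalLeg (true ∷ false ∷ t) ⇔ T (minPathFortᵇ t)
minimalLeg-in⇔ {n} t = ⇔-trans (mk⇔ to from) (⇔-sym (minPathFort⇔ t))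
  where
  to : MinimalLeg (true ∷ false ∷ t) → IsMinimalFort (P n) t
  to (l , min) = Equivalence.to (legFort-true-out⇔ t) l , λ t′ t′⊂t f′ →
    min (true ∷ false ∷ t′) (s⊂s (s⊂s t′⊂t)) (Equivalence.from (legFort-true-out⇔ t′) f′)
  from : IsMinimalFort (P n) t → MinimalLeg (true ∷ false ∷ t)
  from (f , min) = Equivalence.from (legFort-true-out⇔ t) f , λ
    { (true  ∷ false ∷ u) u⊂ l       → min u (drop-∷-⊂ (drop-∷-⊂ u⊂)) (Equivalence.to (legFort-true-out⇔ u) l)
    ; (false ∷ false ∷ u) _  ()
    ; (_     ∷ true  ∷ u) (u⊆ , _) _ → zero∉false∷ (drop-there (u⊆ (there here))) }

minimalLeg⇔ : ∀ {n} (s : Subset n) → MinimalLeg s ⇔ (T (minLegOutᵇ s) ⊎ T (minLegInᵇ s))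
minimalLeg⇔ []                 = mk⇔ (λ _ → inj₁ _) (λ _ → _ , λ { _ (_ , () , _) _ })
minimalLeg⇔ (false ∷ t)        = ⇔-trans (minimalLeg-out⇔ t) (mk⇔ inj₁ λ { (inj₁ m) → m ; (inj₂ ()) })
minimalLeg⇔ (true ∷ [])        =
  mk⇔ (λ _ → inj₂ _) (λ _ → _ , λ { (true ∷ []) u⊂ _ → ⊂-irref refl u⊂ ; (false ∷ []) _ () })
minimalLeg⇔ (true ∷ true ∷ t)  =
  mk⇔ (λ (l , min) → ⊥-elim (min (false ∷ true ∷ t) (out⊂in ⊆-refl) l)) λ { (inj₁ ()) ; (inj₂ ()) }
minimalLeg⇔ (true ∷ false ∷ t) = ⇔-trans (minimalLeg-in⇔ t) (mk⇔ inj₂ λ { (inj₁ ()) ; (inj₂ m) → m })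

keepIfFirst : ∀ {n} → Subset n → Subset n
keepIfFirst []          = []
keepIfFirst (true  ∷ t) = true ∷ t
keepIfFirst (false ∷ t) = ⊥

keepIfFirst-⊆ : ∀ {n} (s : Subset n) → keepIfFirst s ⊆ s
keepIfFirst-⊆ []          = ⊆-refl
keepIfFirst-⊆ (true  ∷ t) = ⊆-refl
keepIfFirst-⊆ (false ∷ t) = ⊥⊆

first-keepIfFirst : ∀ {n} (s : Subset n) → first (keepIfFirst s) ≡ first s
first-keepIfFirst []          = refl
first-keepIfFirst (true  ∷ t) = refl
first-keepIfFirst (false ∷ t) = refl

legFort-keepIfFirst : ∀ {n} (s : Subset n) → T (legFortᵇ true s) → T (legFortᵇ false (keepIfFirst s))
legFort-keepIfFirst []          _ = _
legFort-keepIfFirst (true  ∷ t) l = l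
legFort-keepIfFirst {suc n} (false ∷ t) _ = legFort-false-⊥ (suc n)

-- Minimal forts of the spider

firstCount-mono : ∀ {ls} (ss′ ss : Legs ls) → join ss′ ⊆ join ss → firstCount ss′ ≤ firstCount ss
firstCount-mono []         []       _ = z≤n
firstCount-mono (s′ ∷ ss′) (s ∷ ss) ⊆ss = let (s′⊆s , ss′⊆ss) = ⊆-++⁻ s′ s ⊆ss in
  +-mono-≤ (first-mono s′⊆s) (firstCount-mono ss′ ss ss′⊆ss)

Nonempty-join : ∀ {ls} (ss : Legs ls) → LegsFort false ss → Nonempty (join ss) → 1 ≤ firstCount ss
Nonempty-join (s ∷ ss) (l , ls) ne with Nonempty-++⁻ s ne
... | inj₁ ne-s  = ≤-trans (≤-reflexive (sym (bit-T (legFort-false⇒first s l ne-s)))) (m≤m+n _ _)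
... | inj₂ ne-ss = ≤-trans (Nonempty-join ss ls ne-ss) (m≤n+m _ _)

firstCount⇒Nonempty : ∀ {ls} (ss : Legs ls) → 1 ≤ firstCount ss → Nonempty (join ss)
firstCount⇒Nonempty ((true ∷ s) ∷ ss) _   = zero , here
firstCount⇒Nonempty ([]         ∷ ss) pos = firstCount⇒Nonempty ss pos
firstCount⇒Nonempty ((false ∷ s) ∷ ss) pos = Nonempty-++ʳ (false ∷ s) (firstCount⇒Nonempty ss pos)

spiderFort-out⇔ : ∀ {ls} (ss : Legs ls) →
                  IsFort (spider ls) (false ∷ join ss) ⇔ (LegsFort false ss × 2 ≤ firstCount ss)
spiderFort-out⇔ ss = ⇔-trans (spiderFort⇔ false ss) $ mk⇔
  (λ (ne , ≢1 , ls) → ls , two (Nonempty-join ss ls (Nonempty-tail ne)) (≢1 refl))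
  (λ (ls , 2≤) → Nonempty-cons false (firstCount⇒Nonempty ss (≤-trans (s≤s z≤n) 2≤)) ,
                 (λ _ ≡1 → <-irrefl (sym ≡1) 2≤) , ls)
  where
  two : ∀ {m} → 1 ≤ m → m ≢ 1 → 2 ≤ m
  two {suc zero}    _ ≢1 = ⊥-elim (≢1 refl)
  two {suc (suc m)} _ _  = s≤s (s≤s z≤n)

spiderFort-in⇔ : ∀ {ls} (ss : Legs ls) → IsFort (spider ls) (true ∷ join ss) ⇔ LegsFort true ss
spiderFort-in⇔ ss = ⇔-trans (spiderFort⇔ true ss) (mk⇔ (proj₂ ∘ proj₂) (λ ls → (zero , here) , (λ ()) , ls))

EmptyOrMinimal : ∀ {n} → Subset n → Set
EmptyOrMinimal {n} s = s ≡ ⊥ ⊎ IsMinimalFort (P n) s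

emptyOrMinimal-or-smaller : ∀ {n} (s : Subset n) → T (legFortᵇ false s) →
                 EmptyOrMinimal s ⊎ ∃ λ t → t ⊂ s × T (legFortᵇ false t) × first t ≡ first s
emptyOrMinimal-or-smaller {n} s l with empty-or-pathFort s l
... | inj₁ s≡⊥  = inj₁ (inj₁ s≡⊥)
... | inj₂ fort with minimal-or-smaller (isFort? (P n)) fort
...   | inj₁ min                = inj₁ (inj₂ min)
...   | inj₂ (t , t⊂s , fort-t) =
  inj₂ (t , t⊂s , pathFort⇒legFort t fort-t , T∧T⇒≡ (pathFort⇒first t fort-t) (pathFort⇒first s fort))

legs-emptyOrMinimal-or-smaller : ∀ {ls} (ss : Legs ls) → LegsFort false ss →
                  Every EmptyOrMinimal ss ⊎
                  ∃ λ (ss′ : Legs ls) → join ss′ ⊂ join ss × LegsFort false ss′ × firstCount ss′ ≡ firstCount ss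
legs-emptyOrMinimal-or-smaller []       _        = inj₁ _
legs-emptyOrMinimal-or-smaller (s ∷ ss) (l , ls)
  with emptyOrMinimal-or-smaller s l | legs-emptyOrMinimal-or-smaller ss ls
... | inj₂ (t , t⊂s , l-t , ≡first) | _ =
  inj₂ (t ∷ ss , ⊂-++ˡ (join ss) t⊂s , (l-t , ls) , cong (λ b → bit b + firstCount ss) ≡first)
... | inj₁ g | inj₁ gs = inj₁ (g , gs)
... | inj₁ g | inj₂ (ss′ , ss′⊂ss , ls′ , ≡fc) =
  inj₂ (s ∷ ss′ , ⊂-++ʳ s ss′⊂ss , (l , ls′) , cong (bit (first s) +_) ≡fc)

emptyOneLeg : ∀ {ls} (ss : Legs ls) → LegsFort false ss → 3 ≤ firstCount ss →
              ∃ λ (ss′ : Legs ls) → join ss′ ⊂ join ss × LegsFort false ss′ × 2 ≤ firstCount ss′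
emptyOneLeg {x ∷ _} (s ∷ ss) (l , ls) 3≤fc with T? (first s)
... | yes f = ⊥ ∷ ss , ⊂-++ˡ (join ss) (⊥⊂first s f) , (legFort-false-⊥ x , ls) ,
              subst (λ b → 2 ≤ bit b + firstCount ss) (sym (first-⊥ x)) 2≤fc
  where 2≤fc = ≤-pred (subst (λ k → 3 ≤ k + firstCount ss) (bit-T f) 3≤fc)
... | no ¬f = let (ss′ , ss′⊂ss , ls′ , 2≤) = emptyOneLeg ss ls 3≤fc′ in
              s ∷ ss′ , ⊂-++ʳ s ss′⊂ss , (l , ls′) , ≤-trans 2≤ (m≤n+m _ _)
  where 3≤fc′ = subst (λ k → 3 ≤ k + firstCount ss) (bit-¬T ¬f) 3≤fc

+-tight : ∀ {a a′ b b′} → a′ ≤ a → b′ ≤ b → a + b ≤ a′ + b′ → a ≤ a′ × b ≤ b′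
+-tight {a} {a′} {b} {b′} a′≤a b′≤b a+b≤ =
  +-cancelʳ-≤ b a a′ (≤-trans a+b≤ (+-monoʳ-≤ a′ b′≤b)) ,
  +-cancelˡ-≤ a b b′ (≤-trans a+b≤ (+-monoˡ-≤ b′ a′≤a))

leg-⊆⇒≡-out : ∀ {n} {s′ s : Subset n} → EmptyOrMinimal s → s′ ⊆ s → T (legFortᵇ false s′) →
               bit (first s) ≤ bit (first s′) → s′ ≡ s
leg-⊆⇒≡-out (inj₁ refl) s′⊆⊥ _ _ = ⊆-antisym s′⊆⊥ ⊥⊆
leg-⊆⇒≡-out {s′ = s′} {s} (inj₂ min) s′⊆s l′ first≤ =
  minimal-⊆ min s′⊆s (Equivalence.from (pathFort⇔first s′) (1≤bit⇒T first′ , l′))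
  where
  first′ : 1 ≤ bit (first s′)
  first′ = subst (_≤ bit (first s′)) (bit-T (pathFort⇒first s (proj₁ min))) first≤

join-⊆⇒≡-out : ∀ {ls} (ss′ ss : Legs ls) → Every EmptyOrMinimal ss → join ss′ ⊆ join ss →
            LegsFort false ss′ → firstCount ss ≤ firstCount ss′ → ss′ ≡ ss
join-⊆⇒≡-out []         []       _        _ _          _    = refl
join-⊆⇒≡-out (s′ ∷ ss′) (s ∷ ss) (g , gs) ⊆ss (l′ , ls′) fc≤ =
  let (s′⊆s , ss′⊆ss) = ⊆-++⁻ s′ s ⊆ss
      (first≤ , fc≤′) = +-tight (first-mono s′⊆s) (firstCount-mono ss′ ss ss′⊆ss) fc≤ in
  cong₂ _∷_ (leg-⊆⇒≡-out g s′⊆s l′ first≤) (join-⊆⇒≡-out ss′ ss gs ss′⊆ss ls′ fc≤′)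

minimalFort-out⇔ : ∀ {ls} (ss : Legs ls) →
  IsMinimalFort (spider ls) (false ∷ join ss) ⇔ (Every EmptyOrMinimal ss × firstCount ss ≡ 2)
minimalFort-out⇔ {ls} ss = mk⇔ to from
  where
  to : IsMinimalFort (spider ls) (false ∷ join ss) → Every EmptyOrMinimal ss × firstCount ss ≡ 2
  to (fort , min) with Equivalence.to (spiderFort-out⇔ ss) fort
  ... | ls , 2≤fc with legs-emptyOrMinimal-or-smaller ss ls
  ...   | inj₂ (ss′ , ss′⊂ss , ls′ , ≡fc) =
    ⊥-elim (min _ (s⊂s ss′⊂ss) (Equivalence.from (spiderFort-out⇔ ss′) (ls′ , subst (2 ≤_) (sym ≡fc) 2≤fc)))
  ...   | inj₁ gs with 3 ≤? firstCount ss
  ...     | yes 3≤fc = let (ss′ , ss′⊂ss , ls′ , 2≤fc′) = emptyOneLeg ss ls 3≤fc in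
                       ⊥-elim (min _ (s⊂s ss′⊂ss) (Equivalence.from (spiderFort-out⇔ ss′) (ls′ , 2≤fc′)))
  ...     | no  3≰fc = gs , ≤-antisym (≤-pred (≰⇒> 3≰fc)) 2≤fc
  from : Every EmptyOrMinimal ss × firstCount ss ≡ 2 → IsMinimalFort (spider ls) (false ∷ join ss)
  from (gs , fc≡2) =
    Equivalence.from (spiderFort-out⇔ ss) (Every-map legFort gs , ≤-reflexive (sym fc≡2)) , no-smaller
    where
    legFort : ∀ {n} {s : Subset n} → EmptyOrMinimal s → T (legFortᵇ false s)
    legFort {n}     (inj₁ refl) = legFort-false-⊥ n
    legFort {s = s} (inj₂ min)  = pathFort⇒legFort s (proj₁ min)
    no-smaller : ∀ F′ → F′ ⊂ false ∷ join ss → ¬ IsFort (spider ls) F′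
    no-smaller = spider-subset-elim λ
      { true  ss′ (F′⊆F , _) _ → zero∉false∷ (F′⊆F here)
      ; false ss′ F′⊂F fort′ →
          let (ls′ , 2≤fc′) = Equivalence.to (spiderFort-out⇔ ss′) fort′ in
          ⊂-irref (cong (λ ss″ → false ∷ join ss″)
                        (join-⊆⇒≡-out ss′ ss gs (drop-∷-⊆ (proj₁ F′⊂F)) ls′
                                      (subst (_≤ firstCount ss′) (sym fc≡2) 2≤fc′)))
                  F′⊂F }

legs-minimal-or-smaller : ∀ {ls} (ss : Legs ls) → LegsFort true ss →
                 Every MinimalLeg ss ⊎ ∃ λ (ss′ : Legs ls) → join ss′ ⊂ join ss × LegsFort true ss′
legs-minimal-or-smaller []       _        = inj₁ _
legs-minimal-or-smaller (s ∷ ss) (l , ls)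
  with minimal-or-smaller (T? ∘ legFortᵇ true) l | legs-minimal-or-smaller ss ls
... | inj₂ (t , t⊂s , l-t) | _                      = inj₂ (t ∷ ss , ⊂-++ˡ (join ss) t⊂s , l-t , ls)
... | inj₁ m               | inj₁ ms                = inj₁ (m , ms)
... | inj₁ m               | inj₂ (ss′ , ss′⊂ss , ls′) = inj₂ (s ∷ ss′ , ⊂-++ʳ s ss′⊂ss , l , ls′)

join-⊆⇒≡-in : ∀ {ls} (ss′ ss : Legs ls) → Every MinimalLeg ss → join ss′ ⊆ join ss →
           LegsFort true ss′ → ss′ ≡ ss
join-⊆⇒≡-in []         []       _        _ _          = refl
join-⊆⇒≡-in (s′ ∷ ss′) (s ∷ ss) (m , ms) ⊆ss (l′ , ls′) =
  let (s′⊆s , ss′⊆ss) = ⊆-++⁻ s′ s ⊆ss in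
  cong₂ _∷_ (minimal-⊆ m s′⊆s l′) (join-⊆⇒≡-in ss′ ss ms ss′⊆ss ls′)

keepIfFirsts : ∀ {ls} → Legs ls → Legs ls
keepIfFirsts = All.map keepIfFirst

keepIfFirsts-⊆ : ∀ {ls} (ss : Legs ls) → join (keepIfFirsts ss) ⊆ join ss
keepIfFirsts-⊆ []       = ⊆-refl
keepIfFirsts-⊆ (s ∷ ss) = ⊆-++ (keepIfFirst-⊆ s) (keepIfFirsts-⊆ ss)

firstCount-keepIfFirsts : ∀ {ls} (ss : Legs ls) → firstCount (keepIfFirsts ss) ≡ firstCount ss
firstCount-keepIfFirsts []       = refl
firstCount-keepIfFirsts (s ∷ ss) = cong₂ _+_ (cong bit (first-keepIfFirst s)) (firstCount-keepIfFirsts ss)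

legFort-keepIfFirsts : ∀ {ls} (ss : Legs ls) → LegsFort true ss → LegsFort false (keepIfFirsts ss)
legFort-keepIfFirsts []       _        = _
legFort-keepIfFirsts (s ∷ ss) (l , ls) = legFort-keepIfFirst s l , legFort-keepIfFirsts ss ls

minimalFort-in⇔ : ∀ {ls} (ss : Legs ls) →
  IsMinimalFort (spider ls) (true ∷ join ss) ⇔ (Every MinimalLeg ss × firstCount ss ≤ 1)
minimalFort-in⇔ {ls} ss = mk⇔ to from
  where
  to : IsMinimalFort (spider ls) (true ∷ join ss) → Every MinimalLeg ss × firstCount ss ≤ 1
  to (fort , min) with legs-minimal-or-smaller ss (Equivalence.to (spiderFort-in⇔ ss) fort)
  ... | inj₂ (ss′ , ss′⊂ss , ls′) = ⊥-elim (min _ (s⊂s ss′⊂ss) (Equivalence.from (spiderFort-in⇔ ss′) ls′))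
  ... | inj₁ ms with firstCount ss ≤? 1
  ...   | yes fc≤1 = ms , fc≤1
  -- two legs start inside: keeping only those legs and dropping the junction leaves a fort
  ...   | no  fc≰1 = ⊥-elim (min _ (out⊂in (keepIfFirsts-⊆ ss))
                        (Equivalence.from (spiderFort-out⇔ (keepIfFirsts ss))
                          ( legFort-keepIfFirsts ss (Every-map proj₁ ms)
                          , subst (2 ≤_) (sym (firstCount-keepIfFirsts ss)) (≰⇒> fc≰1))))
  from : Every MinimalLeg ss × firstCount ss ≤ 1 → IsMinimalFort (spider ls) (true ∷ join ss)
  from (ms , fc≤1) = Equivalence.from (spiderFort-in⇔ ss) (Every-map proj₁ ms) , no-smaller
    where
    no-smaller : ∀ F′ → F′ ⊂ true ∷ join ss → ¬ IsFort (spider ls) F′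
    no-smaller = spider-subset-elim λ
      { true  ss′ F′⊂F fort′ →
          ⊂-irref (cong (λ ss″ → true ∷ join ss″)
                        (join-⊆⇒≡-in ss′ ss ms (drop-∷-⊆ (proj₁ F′⊂F))
                                     (Equivalence.to (spiderFort-in⇔ ss′) fort′)))
                  F′⊂F
      ; false ss′ F′⊂F fort′ →
          <-irrefl refl (≤-trans (proj₂ (Equivalence.to (spiderFort-out⇔ ss′) fort′))
                                 (≤-trans (firstCount-mono ss′ ss (drop-∷-⊆ (proj₁ F′⊂F))) fc≤1)) }

exactlyᵇ : ℕ → (A B : ∀ {x} → Subset x → Bool) → ∀ {ls} → Legs ls → Bool
exactlyᵇ zero    A B []       = true
exactlyᵇ (suc r) A B []       = false
exactlyᵇ zero    A B (s ∷ ss) = A s ∧ exactlyᵇ zero A B ss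
exactlyᵇ (suc r) A B (s ∷ ss) = (A s ∧ exactlyᵇ (suc r) A B ss) ∨ (B s ∧ exactlyᵇ r A B ss)

module _ {A B : ∀ {x} → Subset x → Bool}
         (A⇒out : ∀ {x} (s : Subset x) → T (A s) → first s ≡ false)
         (B⇒in  : ∀ {x} (s : Subset x) → T (B s) → first s ≡ true) where

  private
    A-first : ∀ {x} {s : Subset x} m → T (A s) → bit (first s) + m ≡ m
    A-first {s = s} m a = cong (λ b → bit b + m) (A⇒out s a)

    B-first : ∀ {x} {s : Subset x} m → T (B s) → bit (first s) + m ≡ suc m
    B-first {s = s} m b = cong (λ b → bit b + m) (B⇒in s b)

  exactly⇔ : ∀ r {ls} (ss : Legs ls) →
             T (exactlyᵇ r A B ss) ⇔ (Every (λ s → T (A s) ⊎ T (B s)) ss × firstCount ss ≡ r)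
  exactly⇔ zero    []       = mk⇔ (λ _ → _ , refl) _
  exactly⇔ (suc r) []       = mk⇔ (λ ()) (λ ())
  exactly⇔ zero    (s ∷ ss) = mk⇔
    (λ t → let (a , e) = Equivalence.to Bool.T-∧ t
               (es , fc≡0) = Equivalence.to (exactly⇔ zero ss) e in
           (inj₁ a , es) , trans (A-first _ a) fc≡0)
    (λ { ((inj₁ a , es) , fc≡0) →
           Equivalence.from Bool.T-∧
             (a , Equivalence.from (exactly⇔ zero ss) (es , trans (sym (A-first _ a)) fc≡0))
       ; ((inj₂ b , _) , fc≡0) → ⊥-elim (1+n≢0 (trans (sym (B-first _ b)) fc≡0)) })
  exactly⇔ (suc r) (s ∷ ss) = mk⇔
    (λ t → case Equivalence.to Bool.T-∨ t of λ
       { (inj₁ t₁) → let (a , e) = Equivalence.to Bool.T-∧ t₁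
                         (es , fc≡) = Equivalence.to (exactly⇔ (suc r) ss) e in
                     (inj₁ a , es) , trans (A-first _ a) fc≡
       ; (inj₂ t₂) → let (b , e) = Equivalence.to Bool.T-∧ t₂
                         (es , fc≡) = Equivalence.to (exactly⇔ r ss) e in
                     (inj₂ b , es) , trans (B-first _ b) (cong suc fc≡) })
    (λ { ((inj₁ a , es) , fc≡) → Equivalence.from Bool.T-∨ (inj₁ (Equivalence.from Bool.T-∧
           (a , Equivalence.from (exactly⇔ (suc r) ss) (es , trans (sym (A-first _ a)) fc≡))))
       ; ((inj₂ b , es) , fc≡) → Equivalence.from Bool.T-∨ (inj₂ (Equivalence.from Bool.T-∧
           (b , Equivalence.from (exactly⇔ r ss) (es , suc-injective (trans (sym (B-first _ b)) fc≡))))) })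

emptyᵇ : ∀ {n} → Subset n → Bool
emptyᵇ []      = true
emptyᵇ (x ∷ s) = not x ∧ emptyᵇ s

emptyᵇ⇔ : ∀ {n} (s : Subset n) → T (emptyᵇ s) ⇔ s ≡ ⊥
emptyᵇ⇔ []          = mk⇔ (λ _ → refl) _
emptyᵇ⇔ (true  ∷ s) = mk⇔ (λ ()) (λ ())
emptyᵇ⇔ (false ∷ s) = mk⇔ (cong (false ∷_) ∘ Equivalence.to (emptyᵇ⇔ s))
                          (Equivalence.from (emptyᵇ⇔ s) ∘ Vec.∷-injectiveʳ)

emptyᵇ⇒out : ∀ {n} (s : Subset n) → T (emptyᵇ s) → first s ≡ false
emptyᵇ⇒out {n} s e = trans (cong first (Equivalence.to (emptyᵇ⇔ s) e)) (first-⊥ n)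

minPathFortᵇ⇒in : ∀ {n} (s : Subset n) → T (minPathFortᵇ s) → first s ≡ true
minPathFortᵇ⇒in s m = Equivalence.to Bool.T-≡ (pathFort⇒first s (proj₁ (Equivalence.to (minPathFort⇔ s) m)))

minLegOutᵇ⇒out : ∀ {n} (s : Subset n) → T (minLegOutᵇ s) → first s ≡ false
minLegOutᵇ⇒out []          _ = refl
minLegOutᵇ⇒out (false ∷ _) _ = refl

minLegInᵇ⇒in : ∀ {n} (s : Subset n) → T (minLegInᵇ s) → first s ≡ true
minLegInᵇ⇒in (true ∷ [])        _ = refl
minLegInᵇ⇒in (true ∷ false ∷ _) _ = refl

minimalFort-outᵇ : ∀ {ls} (ss : Legs ls) →
                   IsMinimalFort (spider ls) (false ∷ join ss) ⇔ T (exactlyᵇ 2 emptyᵇ minPathFortᵇ ss)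
minimalFort-outᵇ ss = ⇔-trans (minimalFort-out⇔ ss) $
  ⇔-trans (Every-⇔ (λ s → ⇔-sym (emptyᵇ⇔ s ⊎-⇔ minPathFort⇔ s)) ss ×-⇔ ⇔-refl)
          (⇔-sym (exactly⇔ emptyᵇ⇒out minPathFortᵇ⇒in 2 ss))

minimalFort-inᵇ : ∀ {ls} (ss : Legs ls) →
                  IsMinimalFort (spider ls) (true ∷ join ss) ⇔
                  T (exactlyᵇ 0 minLegOutᵇ minLegInᵇ ss ∨ exactlyᵇ 1 minLegOutᵇ minLegInᵇ ss)
minimalFort-inᵇ ss = ⇔-trans (minimalFort-in⇔ ss) $
  ⇔-trans (Every-⇔ minimalLeg⇔ ss ×-⇔ ⇔-refl) $
  ⇔-trans (mk⇔ (λ (es , fc≤1) → Sum.map (λ fc<1 → es , n<1⇒n≡0 fc<1) (es ,_) (m≤n⇒m<n∨m≡n fc≤1))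
               (λ { (inj₁ (es , fc≡0)) → es , subst (_≤ 1) (sym fc≡0) z≤n
                  ; (inj₂ (es , fc≡1)) → es , ≤-reflexive fc≡1 })) $
  ⇔-trans (⇔-sym (exactly⇔ minLegOutᵇ⇒out minLegInᵇ⇒in 0 ss ⊎-⇔ exactly⇔ minLegOutᵇ⇒out minLegInᵇ⇒in 1 ss))
          (⇔-sym Bool.T-∨)

minimalLegsᵇ : Bool → ∀ {ls} → Legs ls → Bool
minimalLegsᵇ false ss = exactlyᵇ 2 emptyᵇ minPathFortᵇ ss
minimalLegsᵇ true  ss = exactlyᵇ 0 minLegOutᵇ minLegInᵇ ss ∨ exactlyᵇ 1 minLegOutᵇ minLegInᵇ ss

minimalFort-legs⇔ : ∀ {ls} c (ss : Legs ls) → IsMinimalFort (spider ls) (c ∷ join ss) ⇔ T (minimalLegsᵇ c ss)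
minimalFort-legs⇔ false = minimalFort-outᵇ
minimalFort-legs⇔ true  = minimalFort-inᵇ

spiderMinimalᵇ : ∀ ls → Subset (suc (sum ls)) → Bool
spiderMinimalᵇ ls (c ∷ S) = minimalLegsᵇ c (legsOf ls S)

minimalFort⇔ : ∀ {ls} (F : Subset (suc (sum ls))) → IsMinimalFort (spider ls) F ⇔ T (spiderMinimalᵇ ls F)
minimalFort⇔ {ls} =
  spider-subset-elim {Q = λ F → IsMinimalFort (spider ls) F ⇔ T (spiderMinimalᵇ ls F)} λ c ss →
  subst (λ ss′ → IsMinimalFort (spider ls) (c ∷ join ss) ⇔ T (minimalLegsᵇ c ss′))
        (sym (legsOf-join {ls} ss)) (minimalFort-legs⇔ {ls} c ss)

-- Counting

count : ∀ {A : Set} → (A → Bool) → List A → ℕ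
count p []       = 0
count p (x ∷ xs) = bit (p x) + count p xs

#subsets : ∀ n → (Subset n → Bool) → ℕ
#subsets n p = count p (allSubsets n)

length-filter≡count : ∀ {A : Set} {P : A → Set} (P? : Decidable P) xs →
                      length (filter P? xs) ≡ count (does ∘ P?) xs
length-filter≡count P? []       = refl
length-filter≡count P? (x ∷ xs) with does (P? x)
... | true  = cong suc (length-filter≡count P? xs)
... | false = length-filter≡count P? xs

T-⇔⇒≡ : ∀ {a b} → T a ⇔ T b → a ≡ b
T-⇔⇒≡ {true}  {true}  _   = refl
T-⇔⇒≡ {true}  {false} a⇔b = ⊥-elim (Equivalence.to a⇔b _)
T-⇔⇒≡ {false} {true}  a⇔b = ⊥-elim (Equivalence.from a⇔b _)
T-⇔⇒≡ {false} {false} _   = refl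

count-⇔ : ∀ {A : Set} {p q : A → Bool} → (∀ x → T (p x) ⇔ T (q x)) → ∀ xs → count p xs ≡ count q xs
count-⇔ p⇔q []       = refl
count-⇔ p⇔q (x ∷ xs) = cong₂ _+_ (cong bit (T-⇔⇒≡ (p⇔q x))) (count-⇔ p⇔q xs)

#MinimalForts≡count : ∀ G (q : Subset (order G) → Bool) → (∀ F → IsMinimalFort G F ⇔ T (q F)) →
                      #MinimalForts G ≡ #subsets (order G) q
#MinimalForts≡count G q minimal⇔q =
  trans (length-filter≡count (isMinimalFort? G) (allSubsets (order G)))
        (count-⇔ (λ F → ⇔-trans (T-does⇔ (isMinimalFort? G F)) (minimal⇔q F)) (allSubsets (order G)))

count-false : ∀ {A : Set} (xs : List A) → count (λ _ → false) xs ≡ 0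
count-false []       = refl
count-false (_ ∷ xs) = count-false xs

count-++ : ∀ {A : Set} (p : A → Bool) xs ys → count p (xs ++ₗ ys) ≡ count p xs + count p ys
count-++ p []       ys = refl
count-++ p (x ∷ xs) ys = trans (cong (bit (p x) +_) (count-++ p xs ys)) (sym (+-assoc (bit (p x)) _ _))

count-map : ∀ {A B : Set} (p : B → Bool) (f : A → B) xs → count p (map f xs) ≡ count (p ∘ f) xs
count-map p f []       = refl
count-map p f (x ∷ xs) = cong (bit (p (f x)) +_) (count-map p f xs)

count-∨ : ∀ {A : Set} {p q : A → Bool} → (∀ x → T (p x) → ¬ T (q x)) →
          ∀ xs → count (λ x → p x ∨ q x) xs ≡ count p xs + count q xs
count-∨ {p = p} {q} disjoint []       = refl
count-∨ {p = p} {q} disjoint (x ∷ xs) = begin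
  bit (p x ∨ q x) + count (λ x → p x ∨ q x) xs
    ≡⟨ cong₂ _+_ (bit-∨ (p x) (q x) (disjoint x)) (count-∨ disjoint xs) ⟩
  (bit (p x) + bit (q x)) + (count p xs + count q xs)
    ≡⟨ +-interchange (bit (p x)) (bit (q x)) _ _ ⟩
  (bit (p x) + count p xs) + (bit (q x) + count q xs) ∎
  where
  bit-∨ : ∀ a b → (T a → ¬ T b) → bit (a ∨ b) ≡ bit a + bit b
  bit-∨ true  true  a⇒¬b = ⊥-elim (a⇒¬b _ _)
  bit-∨ true  false _    = refl
  bit-∨ false _     _    = refl

#subsets-suc : ∀ n (p : Subset (suc n) → Bool) →
               #subsets (suc n) p ≡ #subsets n (p ∘ (true ∷_)) + #subsets n (p ∘ (false ∷_))
#subsets-suc n p =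
  trans (count-++ p (map (true ∷_) (allSubsets n)) _)
        (cong₂ _+_ (count-map p (true ∷_) (allSubsets n)) (count-map p (false ∷_) (allSubsets n)))

#subsets-take-drop : ∀ m {n} (b : Subset m → Bool) (q : Subset n → Bool) →
                     #subsets (m + n) (λ S → b (take m S) ∧ q (drop m S)) ≡ #subsets m b * #subsets n q
#subsets-take-drop zero {n} b q with b []
... | true  = sym (+-identityʳ (#subsets n q))
... | false = count-false (allSubsets n)
#subsets-take-drop (suc m) {n} b q = begin
  #subsets (suc (m + n)) (λ S → b (take (suc m) S) ∧ q (drop (suc m) S))
    ≡⟨ #subsets-suc (m + n) _ ⟩
  #subsets (m + n) (λ S → b (true ∷ take m S) ∧ q (drop m S)) +
  #subsets (m + n) (λ S → b (false ∷ take m S) ∧ q (drop m S))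
    ≡⟨ cong₂ _+_ (#subsets-take-drop m (b ∘ (true ∷_)) q) (#subsets-take-drop m (b ∘ (false ∷_)) q) ⟩
  #subsets m (b ∘ (true ∷_)) * #subsets n q + #subsets m (b ∘ (false ∷_)) * #subsets n q
    ≡⟨ sym (*-distribʳ-+ (#subsets n q) (#subsets m (b ∘ (true ∷_))) _) ⟩
  (#subsets m (b ∘ (true ∷_)) + #subsets m (b ∘ (false ∷_))) * #subsets n q
    ≡⟨ cong (_* #subsets n q) (sym (#subsets-suc m b)) ⟩
  #subsets (suc m) b * #subsets n q ∎

-- esym r ((a₁ , b₁) ∷ … ∷ (aₖ , bₖ) ∷ []) = Σ_{I ⊆ {1 … k}, |I| = r} Π_{i ∈ I} bᵢ · Π_{i ∉ I} aᵢ
esym : ℕ → List (ℕ × ℕ) → ℕ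
esym zero    []             = 1
esym (suc r) []             = 0
esym zero    ((a , b) ∷ ps) = a * esym zero ps
esym (suc r) ((a , b) ∷ ps) = a * esym (suc r) ps + b * esym r ps

disjoint-by-first : ∀ {A B : ∀ {x} → Subset x → Bool} →
  (∀ {x} (s : Subset x) → T (A s) → first s ≡ false) → (∀ {x} (s : Subset x) → T (B s) → first s ≡ true) →
  ∀ {x} (s : Subset x) → T (A s) → ¬ T (B s)
disjoint-by-first A⇒out B⇒in s a b with trans (sym (A⇒out s a)) (B⇒in s b)
... | ()

#subsets-exactly : ∀ {A B : ∀ {x} → Subset x → Bool} → (∀ {x} (s : Subset x) → T (A s) → ¬ T (B s)) →
  ∀ r ls → #subsets (sum ls) (exactlyᵇ r A B ∘ legsOf ls) ≡ esym r (map (λ x → #subsets x A , #subsets x B) ls)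
#subsets-exactly disjoint zero    []       = refl
#subsets-exactly disjoint (suc r) []       = refl
#subsets-exactly {A} {B} disjoint zero (x ∷ xs) =
  trans (#subsets-take-drop x A (E zero)) (cong (#subsets x A *_) (#subsets-exactly disjoint zero xs))
  where
  E : ℕ → Subset (sum xs) → Bool
  E r = exactlyᵇ r A B ∘ legsOf xs
#subsets-exactly {A} {B} disjoint (suc r) (x ∷ xs) = begin
  #subsets (x + sum xs) (λ S → (A (take x S) ∧ E (suc r) (drop x S)) ∨ (B (take x S) ∧ E r (drop x S)))
    ≡⟨ count-∨ (λ S a b → disjoint (take x S) (∧-true₁ a) (∧-true₁ b)) (allSubsets (x + sum xs)) ⟩
  #subsets (x + sum xs) (λ S → A (take x S) ∧ E (suc r) (drop x S)) +
  #subsets (x + sum xs) (λ S → B (take x S) ∧ E r (drop x S))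
    ≡⟨ cong₂ _+_ (#subsets-take-drop x A (E (suc r))) (#subsets-take-drop x B (E r)) ⟩
  #subsets x A * #subsets (sum xs) (E (suc r)) + #subsets x B * #subsets (sum xs) (E r)
    ≡⟨ cong₂ _+_ (cong (#subsets x A *_) (#subsets-exactly disjoint (suc r) xs))
                 (cong (#subsets x B *_) (#subsets-exactly disjoint r xs)) ⟩
  esym (suc r) (map (λ x → #subsets x A , #subsets x B) (x ∷ xs)) ∎
  where
  E : ℕ → Subset (sum xs) → Bool
  E r = exactlyᵇ r A B ∘ legsOf xs
  ∧-true₁ : ∀ {a b} → T (a ∧ b) → T a
  ∧-true₁ = proj₁ ∘ Equivalence.to Bool.T-∧

-- For a leg of length x: the numbers of admissible legs avoiding, resp. containing, their first
-- vertex, when the junction is in, resp. outside, the minimal fort.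
legWeights-in legWeights-out : ℕ → ℕ × ℕ
legWeights-in  x = #subsets x minLegOutᵇ , #subsets x minLegInᵇ
legWeights-out x = #subsets x emptyᵇ , #subsets x minPathFortᵇ

#minimalForts-spider : ∀ ls →
  #MinimalForts (spider ls) ≡
    esym 0 (map legWeights-in ls) + esym 1 (map legWeights-in ls) + esym 2 (map legWeights-out ls)
#minimalForts-spider ls = begin
  #MinimalForts (spider ls)
    ≡⟨ #MinimalForts≡count (spider ls) (spiderMinimalᵇ ls) minimalFort⇔ ⟩
  #subsets (suc (sum ls)) (spiderMinimalᵇ ls)
    ≡⟨ #subsets-suc (sum ls) (spiderMinimalᵇ ls) ⟩
  #subsets (sum ls) (λ S → In 0 S ∨ In 1 S) + #subsets (sum ls) Out
    ≡⟨ cong (_+ #subsets (sum ls) Out) (count-∨ (λ S → In0⇒¬In1 (legsOf ls S)) (allSubsets (sum ls))) ⟩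
  #subsets (sum ls) (In 0) + #subsets (sum ls) (In 1) + #subsets (sum ls) Out
    ≡⟨ cong₂ _+_ (cong₂ _+_ (#subsets-exactly (disjoint-by-first minLegOutᵇ⇒out minLegInᵇ⇒in) 0 ls)
                            (#subsets-exactly (disjoint-by-first minLegOutᵇ⇒out minLegInᵇ⇒in) 1 ls))
                 (#subsets-exactly (disjoint-by-first emptyᵇ⇒out minPathFortᵇ⇒in) 2 ls) ⟩
  esym 0 (map legWeights-in ls) + esym 1 (map legWeights-in ls) + esym 2 (map legWeights-out ls) ∎
  where
  In : ℕ → Subset (sum ls) → Bool
  In r = exactlyᵇ r minLegOutᵇ minLegInᵇ ∘ legsOf ls
  Out : Subset (sum ls) → Bool
  Out = exactlyᵇ 2 emptyᵇ minPathFortᵇ ∘ legsOf ls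
  In0⇒¬In1 : (ss : Legs ls) → T (exactlyᵇ 0 minLegOutᵇ minLegInᵇ ss) → ¬ T (exactlyᵇ 1 minLegOutᵇ minLegInᵇ ss)
  In0⇒¬In1 ss e₀ e₁ = 0≢1+n (trans (sym (proj₂ (Equivalence.to (exactly⇔ minLegOutᵇ⇒out minLegInᵇ⇒in 0 ss) e₀)))
                                   (proj₂ (Equivalence.to (exactly⇔ minLegOutᵇ⇒out minLegInᵇ⇒in 1 ss) e₁)))

#subsets-emptyᵇ : ∀ n → #subsets n emptyᵇ ≡ 1
#subsets-emptyᵇ zero    = refl
#subsets-emptyᵇ (suc n) =
  trans (#subsets-suc n emptyᵇ) (cong₂ _+_ (count-false (allSubsets n)) (#subsets-emptyᵇ n))

#subsets-minPathFortᵇ : ∀ n → #subsets n minPathFortᵇ ≡ fP n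
#subsets-minPathFortᵇ n = sym (length-filter≡count (isMinimalFort? (P n)) (allSubsets n))

#subsets-minLegOutᵇ : ∀ n → #subsets n minLegOutᵇ ≡ fP₋₁ n
#subsets-minLegOutᵇ zero    = refl
#subsets-minLegOutᵇ (suc n) =
  trans (#subsets-suc n minLegOutᵇ) (cong₂ _+_ (count-false (allSubsets n)) (#subsets-minPathFortᵇ n))

#subsets-minLegInᵇ : ∀ n → #subsets (suc n) minLegInᵇ ≡ fP₋₁ n
#subsets-minLegInᵇ zero    = refl
#subsets-minLegInᵇ (suc n) = begin
  #subsets (suc (suc n)) minLegInᵇ
    ≡⟨ #subsets-suc (suc n) minLegInᵇ ⟩
  #subsets (suc n) (λ S → minLegInᵇ (true ∷ S)) + #subsets (suc n) (λ _ → false)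
    ≡⟨ cong₂ _+_ (#subsets-suc n (λ S → minLegInᵇ (true ∷ S))) (count-false (allSubsets (suc n))) ⟩
  (#subsets n (λ _ → false) + #subsets n minPathFortᵇ) + 0
    ≡⟨ trans (+-identityʳ _) (cong (_+ #subsets n minPathFortᵇ) (count-false (allSubsets n))) ⟩
  #subsets n minPathFortᵇ
    ≡⟨ #subsets-minPathFortᵇ n ⟩
  fP n ∎

legWeights-in≡ : ∀ {x} → 1 ≤ x → legWeights-in x ≡ (fP₋₁ x , fP₋₁ (x ∸ 1))
legWeights-in≡ {suc y} _ = cong₂ _,_ (#subsets-minLegOutᵇ (suc y)) (#subsets-minLegInᵇ y)

legWeights-out≡ : ∀ x → legWeights-out x ≡ (1 , fP x)
legWeights-out≡ x = cong₂ _,_ (#subsets-emptyᵇ x) (#subsets-minPathFortᵇ x)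

-- Sums and products over Fin k

map-allFin-suc : ∀ {A : Set} {k} (f : Fin (suc k) → A) →
                 map f (allFin (suc k)) ≡ f zero ∷ map (f ∘ suc) (allFin k)
map-allFin-suc f = cong (f zero ∷_) (trans (List.map-tabulate suc f) (sym (List.map-tabulate id (f ∘ suc))))

Σ[<]-suc : ∀ k (f : Fin (suc k) → ℕ) → Σ[< suc k ] f ≡ f zero + Σ[< k ] (f ∘ suc)
Σ[<]-suc k f = cong sum (map-allFin-suc f)

Π[<]-suc : ∀ k (f : Fin (suc k) → ℕ) → Π[< suc k ] f ≡ f zero * Π[< k ] (f ∘ suc)
Π[<]-suc k f = cong product (map-allFin-suc f)

Σ[<]-cong : ∀ k {f g : Fin k → ℕ} → (∀ i → f i ≡ g i) → Σ[< k ] f ≡ Σ[< k ] g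
Σ[<]-cong k f≗g = cong sum (List.map-cong f≗g (allFin k))

Σ[<]-*ˡ : ∀ k c (f : Fin k → ℕ) → Σ[< k ] (λ i → c * f i) ≡ c * Σ[< k ] f
Σ[<]-*ˡ zero    c f = sym (*-zeroʳ c)
Σ[<]-*ˡ (suc k) c f = begin
  Σ[< suc k ] (λ i → c * f i)          ≡⟨ Σ[<]-suc k _ ⟩
  c * f zero + Σ[< k ] (λ i → c * f (suc i)) ≡⟨ cong (c * f zero +_) (Σ[<]-*ˡ k c (f ∘ suc)) ⟩
  c * f zero + c * Σ[< k ] (f ∘ suc)     ≡⟨ sym (*-distribˡ-+ c (f zero) _) ⟩
  c * (f zero + Σ[< k ] (f ∘ suc))       ≡⟨ cong (c *_) (sym (Σ[<]-suc k f)) ⟩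
  c * Σ[< suc k ] f                     ∎

Π[<]≠-zero : ∀ k (a : Fin (suc k) → ℕ) → Π[< suc k ]≠ zero a ≡ Π[< k ] (a ∘ suc)
Π[<]≠-zero k a = trans (Π[<]-suc k (λ j → if toℕ j ≡ᵇ 0 then 1 else a j)) (*-identityˡ _)

Π[<]≠-suc : ∀ k i (a : Fin (suc k) → ℕ) → Π[< suc k ]≠ (suc i) a ≡ a zero * Π[< k ]≠ i (a ∘ suc)
Π[<]≠-suc k i a = Π[<]-suc k (λ j → if toℕ j ≡ᵇ suc (toℕ i) then 1 else a j)

Σ[<]pairs-suc : ∀ k (g : Fin (suc k) → Fin (suc k) → ℕ) →
  Σ[< suc k ]pairs g ≡ Σ[< k ] (λ j → g zero (suc j)) + Σ[< k ]pairs (λ i j → g (suc i) (suc j))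
Σ[<]pairs-suc k g = trans (Σ[<]-suc k _)
  (cong₂ _+_ (Σ[<]-suc k (λ j → if 0 <ᵇ toℕ j then g zero j else 0))
             (Σ[<]-cong k (λ i → Σ[<]-suc k (λ j → if suc (toℕ i) <ᵇ toℕ j then g (suc i) j else 0))))

esym-0 : ∀ k (a b : Fin k → ℕ) → esym 0 (map (λ i → a i , b i) (allFin k)) ≡ Π[< k ] a
esym-0 zero    a b = refl
esym-0 (suc k) a b = begin
  esym 0 (map (λ i → a i , b i) (allFin (suc k)))
    ≡⟨ cong (esym 0) (map-allFin-suc (λ i → a i , b i)) ⟩
  a zero * esym 0 (map (λ i → a (suc i) , b (suc i)) (allFin k))
    ≡⟨ cong (a zero *_) (esym-0 k (a ∘ suc) (b ∘ suc)) ⟩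
  a zero * Π[< k ] (a ∘ suc)
    ≡⟨ sym (Π[<]-suc k a) ⟩
  Π[< suc k ] a ∎

esym-1 : ∀ k (a b : Fin k → ℕ) →
         esym 1 (map (λ i → a i , b i) (allFin k)) ≡ Σ[< k ] (λ i → b i * Π[< k ]≠ i a)
esym-1 zero    a b = refl
esym-1 (suc k) a b = begin
  esym 1 (map (λ i → a i , b i) (allFin (suc k)))
    ≡⟨ cong (esym 1) (map-allFin-suc (λ i → a i , b i)) ⟩
  a zero * esym 1 ps + b zero * esym 0 ps
    ≡⟨ cong₂ _+_ (cong (a zero *_) (esym-1 k (a ∘ suc) (b ∘ suc)))
                 (cong (b zero *_) (esym-0 k (a ∘ suc) (b ∘ suc))) ⟩
  a zero * Σ[< k ] (λ i → b (suc i) * Π[< k ]≠ i (a ∘ suc)) + b zero * Π[< k ] (a ∘ suc)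
    ≡⟨ +-comm (a zero * Σ[< k ] (λ i → b (suc i) * Π[< k ]≠ i (a ∘ suc))) _ ⟩
  b zero * Π[< k ] (a ∘ suc) + a zero * Σ[< k ] (λ i → b (suc i) * Π[< k ]≠ i (a ∘ suc))
    ≡⟨ cong₂ _+_ (cong (b zero *_) (sym (Π[<]≠-zero k a))) (sym (Σ[<]-*ˡ k (a zero) _)) ⟩
  b zero * Π[< suc k ]≠ zero a + Σ[< k ] (λ i → a zero * (b (suc i) * Π[< k ]≠ i (a ∘ suc)))
    ≡⟨ cong (b zero * Π[< suc k ]≠ zero a +_) (Σ[<]-cong k λ i →
         trans (x∙yz≈y∙xz (a zero) (b (suc i)) _) (cong (b (suc i) *_) (sym (Π[<]≠-suc k i a)))) ⟩
  b zero * Π[< suc k ]≠ zero a + Σ[< k ] (λ i → b (suc i) * Π[< suc k ]≠ (suc i) a)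
    ≡⟨ sym (Σ[<]-suc k _) ⟩
  Σ[< suc k ] (λ i → b i * Π[< suc k ]≠ i a) ∎
  where
  ps = map (λ i → a (suc i) , b (suc i)) (allFin k)
  x∙yz≈y∙xz : ∀ x y z → x * (y * z) ≡ y * (x * z)
  x∙yz≈y∙xz x y z = trans (sym (*-assoc x y z)) (trans (cong (_* z) (*-comm x y)) (*-assoc y x z))

esym-0-unit : ∀ k (b : Fin k → ℕ) → esym 0 (map (λ i → 1 , b i) (allFin k)) ≡ 1
esym-0-unit zero    b = refl
esym-0-unit (suc k) b =
  trans (cong (esym 0) (map-allFin-suc (λ i → 1 , b i))) (trans (+-identityʳ _) (esym-0-unit k (b ∘ suc)))

esym-1-unit : ∀ k (b : Fin k → ℕ) → esym 1 (map (λ i → 1 , b i) (allFin k)) ≡ Σ[< k ] b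
esym-1-unit zero    b = refl
esym-1-unit (suc k) b = begin
  esym 1 (map (λ i → 1 , b i) (allFin (suc k)))
    ≡⟨ cong (esym 1) (map-allFin-suc (λ i → 1 , b i)) ⟩
  1 * esym 1 ps + b zero * esym 0 ps
    ≡⟨ cong₂ _+_ (trans (*-identityˡ _) (esym-1-unit k (b ∘ suc)))
                 (trans (cong (b zero *_) (esym-0-unit k (b ∘ suc))) (*-identityʳ _)) ⟩
  Σ[< k ] (b ∘ suc) + b zero
    ≡⟨ trans (+-comm (Σ[< k ] (b ∘ suc)) (b zero)) (sym (Σ[<]-suc k b)) ⟩
  Σ[< suc k ] b ∎
  where ps = map (λ i → 1 , b (suc i)) (allFin k)

esym-2-unit : ∀ k (b : Fin k → ℕ) →
              esym 2 (map (λ i → 1 , b i) (allFin k)) ≡ Σ[< k ]pairs (λ i j → b i * b j)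
esym-2-unit zero    b = refl
esym-2-unit (suc k) b = begin
  esym 2 (map (λ i → 1 , b i) (allFin (suc k)))
    ≡⟨ cong (esym 2) (map-allFin-suc (λ i → 1 , b i)) ⟩
  1 * esym 2 ps + b zero * esym 1 ps
    ≡⟨ cong₂ _+_ (trans (*-identityˡ _) (esym-2-unit k (b ∘ suc)))
                 (cong (b zero *_) (esym-1-unit k (b ∘ suc))) ⟩
  pairs′ + b zero * Σ[< k ] (b ∘ suc)
    ≡⟨ trans (+-comm pairs′ _) (cong (_+ pairs′) (sym (Σ[<]-*ˡ k (b zero) (b ∘ suc)))) ⟩
  Σ[< k ] (λ j → b zero * b (suc j)) + pairs′
    ≡⟨ sym (Σ[<]pairs-suc k (λ i j → b i * b j)) ⟩
  Σ[< suc k ]pairs (λ i j → b i * b j) ∎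
  where
  ps = map (λ i → 1 , b (suc i)) (allFin k)
  pairs′ = Σ[< k ]pairs (λ i j → b (suc i) * b (suc j))

theorem4p11 : (k : ℕ) → 2 ≤ k → (l : Fin k → ℕ) → (∀ i → 1 ≤ l i) →
    #MinimalForts (Spider k l)
      ≡ Π[< k ] (λ i → fP₋₁ (l i))
        + Σ[< k ] (λ i → fP₋₁ (l i ∸ 1) * Π[< k ]≠ i (λ j → fP₋₁ (l j)))
        + Σ[< k ]pairs (λ i j → fP (l i) * fP (l j))
theorem4p11 k _ l 1≤l = begin
  #MinimalForts (Spider k l)
    ≡⟨ #minimalForts-spider ls ⟩
  esym 0 (map legWeights-in ls) + esym 1 (map legWeights-in ls) + esym 2 (map legWeights-out ls)
    ≡⟨ cong₂ (λ ws ws′ → esym 0 ws + esym 1 ws + esym 2 ws′)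
             (map-over-legs (λ i → legWeights-in≡ (1≤l i))) (map-over-legs (λ i → legWeights-out≡ (l i))) ⟩
  esym 0 (map w-in (allFin k)) + esym 1 (map w-in (allFin k)) + esym 2 (map w-out (allFin k))
    ≡⟨ cong₂ _+_ (cong₂ _+_ (esym-0 k _ _) (esym-1 k _ _)) (esym-2-unit k (fP ∘ l)) ⟩
  Π[< k ] (λ i → fP₋₁ (l i))
    + Σ[< k ] (λ i → fP₋₁ (l i ∸ 1) * Π[< k ]≠ i (λ j → fP₋₁ (l j)))
    + Σ[< k ]pairs (λ i j → fP (l i) * fP (l j)) ∎
  where
  ls = map l (allFin k)
  w-in w-out : Fin k → ℕ × ℕ
  w-in  i = fP₋₁ (l i) , fP₋₁ (l i ∸ 1)
  w-out i = 1 , fP (l i)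
  map-over-legs : ∀ {f : ℕ → ℕ × ℕ} {g : Fin k → ℕ × ℕ} → (∀ i → f (l i) ≡ g i) →
                  map f ls ≡ map g (allFin k)
  map-over-legs f∘l≗g = trans (sym (List.map-∘ (allFin k))) (List.map-cong f∘l≗g (allFin k))
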